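{- Let $G$ be a finite, simple and connected graph with totally ordered vertex set, let $u\in V(G)$, and let $(T_G,u')$ and $\ell_G:V(T_G)\to V(G)$ be the stable-path tree and its labelling map as described in the context. Then there exists a bijection $\varphi_G:\mathcal{P}^{\emptyset}_u(G)\to\mathcal{P}^{\emptyset}_{u'}(T_G)$ such that $|\varphi_G(\mathbf{w})|=|\mathbf{w}|$ for all $\mathbf{w}$ and $\ell_G\circ\pi_{T_G}\circ\varphi_G=\pi_G$ on $\mathcal{P}^{\emptyset}_u(G)$.
   Context: For a finite simple graph $H$, $\mathcal{P}^{\emptyset}(H)$ is the monoid generated by $V(H)$ subject only to $ab=ba$ for distinct non-adjacent $a,b$; its elements are words, $|\mathbf{w}|$ is the length of $\mathbf{w}$, and $\mathcal{P}(H)$ denotes non-empty words. The initial alphabet $\mathrm{IA}(\mathbf{w})$ of a non-empty word is the set of $v$ with $\mathbf{w}=\mathbf{u}v$ for some word $\mathbf{u}$. For $x\in V(H)$, $\mathcal{P}^{\emptyset}_x(H)$ is the set consisting of the empty word together with all non-empty words $\mathbf{w}$ with $\mathrm{IA}(\mathbf{w})\subseteq\{x\}$. $\mathcal{C}^{\emptyset}(H)$ is the free commutative monoid on $V(H)$ and $\pi_H:\mathcal{P}^{\emptyset}(H)\to\mathcal{C}^{\emptyset}(H)$ is the canonical monoid morphism. Stable-path tree: for a finite connected simple graph $G$ with totally ordered vertex set and $u\in V(G)$, with $N_G(u)=\{u_1<\cdots<u_d\}$, define recursively a rooted tree $(T_G,u')$ and a surjective graph homomorphism $\ell_G:V(T_G)\to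 V(G)$ with $\ell_G(u')=u$. If $d=0$ ($G$ is a single vertex), $T_G$ is the single vertex $u'$. If $d\ge1$, for $1\le i\le d$ let $G_i$ be the connected component of $G[V(G)\setminus\{u,u_1,\dots,u_{i-1}\}]$ containing $u_i$, with the induced order, and let $(T_{G_i},u_i')$, $\ell_{G_i}$ be its tree rooted at $u_i$ obtained recursively. Then $T_G$ is the disjoint union of the $T_{G_i}$ together with a new vertex $u'$ joined to $u_1',\dots,u_d'$; $\ell_G(u')=u$ and $\ell_G(x)=\ell_{G_i}(x)$ for $x\in V(T_{G_i})$. The map $\ell_G$ is extended to a monoid morphism $\mathcal{C}^{\emptyset}(T_G)\to\mathcal{C}^{\emptyset}(G)$. -}

module Defs where

open import Data.Nat using (ℕ; zero; suc)
open import Data.Fin using (Fin)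
open import Data.Bool using (Bool; true; false; _∧_; _∨_; not)
open import Data.List using (List; []; _∷_; _++_; _∷ʳ_; filter; allFin; map; length)
open import Data.Bool.ListAction using (any)
open import Data.Sum using (_⊎_)
open import Data.Maybe using (Maybe; just; nothing; maybe)
open import Data.Product using (Σ; ∃; _×_; _,_)
open import Relation.Nullary using (¬_)
open import Relation.Binary.PropositionalEquality using (_≡_; _≢_)
open import Data.Fin using (_≟_)
open import Relation.Nullary.Decidable using (does)
open import Data.Bool using (T; T?)

-- Partially commutative monoids P^∅(H), represented by words (lists)
-- modulo the congruence generated by  ab = ba  for distinct
-- non-adjacent a, b.

module PartComm {V : Set} (Adj : V → V → Set) where

  infix 4 _≈_
  data _≈_ : List V → List V → Set where
    ≈-refl  : ∀ {w} → w ≈ w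
    ≈-sym   : ∀ {w w'} → w ≈ w' → w' ≈ w
    ≈-trans : ∀ {w w' w''} → w ≈ w' → w' ≈ w'' → w ≈ w''
    ≈-swap  : ∀ xs ys a b → a ≢ b → ¬ Adj a b →
              (xs ++ a ∷ b ∷ ys) ≈ (xs ++ b ∷ a ∷ ys)

  InIA : List V → V → Set
  InIA w v = ∃ λ u → w ≈ (u ∷ʳ v)

  -- w ∈ P^∅_x(H) : w empty, or IA(w) ⊆ {x}
  -- (the empty word has empty initial alphabet, so one condition suffices)
  InP : V → List V → Set
  InP x w = ∀ v → InIA w v → v ≡ x

module _ {n : ℕ} where

  Adjacent : (Fin n → Fin n → Bool) → Fin n → Fin n → Set
  Adjacent adj a b = adj a b ≡ true

  data Reach (adj : Fin n → Fin n → Bool) (a : Fin n) : Fin n → Set where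
    here : Reach adj a a
    step : ∀ {b c} → Reach adj a b → adj b c ≡ true → Reach adj a c

Connected : {n : ℕ} → (Fin n → Fin n → Bool) → Set
Connected {n} adj = (a b : Fin n) → Reach adj a b

Symmetric : {n : ℕ} → (Fin n → Fin n → Bool) → Set
Symmetric {n} adj = (a b : Fin n) → adj a b ≡ adj b a

Irreflexive : {n : ℕ} → (Fin n → Fin n → Bool) → Set
Irreflexive {n} adj = (a : Fin n) → adj a a ≡ false

data Tree (n : ℕ) : Set where
  node : Fin n → List (Tree n) → Tree n

module StablePath {n : ℕ} (adj : Fin n → Fin n → Bool) where

  Subset : Set
  Subset = Fin n → Bool

  remove : Fin n → Subset → Subset
  remove v S w = S w ∧ not (does (v ≟ w))

  nbrs : Subset → Fin n → List (Fin n)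
  nbrs S u = filter (λ v → T? (S v ∧ adj u v)) (allFin n)

  singleton : Fin n → Subset
  singleton v w = does (v ≟ w)

  closeStep : Subset → Subset → Subset
  closeStep S R v = R v ∨ (S v ∧ any (λ w → R w ∧ adj w v) (allFin n))

  iterate : ℕ → Subset → Subset → Subset
  iterate zero    S R = R
  iterate (suc k) S R = iterate k S (closeStep S R)

  -- vertex set of the connected component of G[S] containing v (v ∈ S);
  -- n closure steps suffice since components have at most n vertices
  component : Subset → Fin n → Subset
  component S v = iterate n S (singleton v)

  -- build f S u : stable-path tree of G[S] (S connected, u ∈ S) rooted at
  -- u; the fuel f is ≥ |S| at every call, so fuel never runs out
  -- prematurely (each level removes the root).
  mutual
    build : ℕ → Subset → Fin n → Tree n
    build zero    S u = node u []
    build (suc f) S u = node u (children f (remove u S) (nbrs S u))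

    -- children f S' [u_i, …, u_d] with S' = S \ {u, u_1, …, u_{i-1}}
    children : ℕ → Subset → List (Fin n) → List (Tree n)
    children f S' []       = []
    children f S' (v ∷ vs) = build f (component S' v) v ∷ children f (remove v S') vs

  stablePathTree : Fin n → Tree n
  stablePathTree u = build n (λ _ → true) u

-- Vertices of a tree as addresses (root-first lists of child indices)

Addr : Set
Addr = List ℕ

nth : {A : Set} → List A → ℕ → Maybe A
nth []       _       = nothing
nth (x ∷ xs) zero    = just x
nth (x ∷ xs) (suc i) = nth xs i

subtree : {n : ℕ} → Tree n → Addr → Maybe (Tree n)
subtree t [] = just t
subtree (node x ts) (i ∷ a) with nth ts i
... | nothing = nothing
... | just s  = subtree s a

rootLabel : {n : ℕ} → Tree n → Fin n
rootLabel (node x _) = x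

ValidAddr : {n : ℕ} → Tree n → Addr → Set
ValidAddr t a = ∃ λ s → subtree t a ≡ just s

-- the labelling ℓ : V(T) → Fin n (value on invalid addresses irrelevant)
label : {n : ℕ} → Tree n → Addr → Fin n
label t a = maybe rootLabel (rootLabel t) (subtree t a)

TreeAdj : Addr → Addr → Set
TreeAdj a b = (∃ λ i → b ≡ a ∷ʳ i) ⊎ (∃ λ i → a ≡ b ∷ʳ i)

data ValidWord {n : ℕ} (t : Tree n) : List Addr → Set where
  []  : ValidWord t []
  _∷_ : ∀ {a w} → ValidAddr t a → ValidWord t w → ValidWord t (a ∷ w)

EqG : {n : ℕ} → (Fin n → Fin n → Bool) → List (Fin n) → List (Fin n) → Set
EqG adj = PartComm._≈_ (Adjacent adj)

InPG : {n : ℕ} → (Fin n → Fin n → Bool) → Fin n → List (Fin n) → Set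
InPG adj = PartComm.InP (Adjacent adj)

EqT : List Addr → List Addr → Set
EqT = PartComm._≈_ TreeAdj

-- membership in P^∅_a(T) (the root u' has address [])
InPT : Addr → List Addr → Set
InPT = PartComm.InP TreeAdj

stablePathTree : {n : ℕ} → (Fin n → Fin n → Bool) → Fin n → Tree n
stablePathTree adj = StablePath.stablePathTree adj

module Submission where

-- A pyramid at u (a word whose only possible last letter is u) decomposes, after removing its apex,
-- in the trace monoid: the letters lying under an earlier u form again a pyramid at u, and the
-- remaining letters split, for u₁ < ⋯ < u_d in turn, into the letters lying under uᵢ, a pyramid at
-- uᵢ inside Gᵢ; nothing else is left, since a leftover letter would commute past the apex.  The root
-- u′ of T_G and its subtrees T_{Gᵢ} mirror this decomposition, so sending the apex to u′ and each part
-- recursively into the corresponding subtree gives a length- and label-preserving map.  It respects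
-- commutations because the decomposition does, and it is inverted by restricting a pyramid of T_G to
-- the subtrees of the root.

open import Defs
import Data.Nat
open import Data.Nat using (ℕ; zero; suc; _+_; _<_; _≤_; s≤s; s≤s⁻¹; z≤n)
open import Data.Nat.Properties using (≤-refl; ≤-reflexive; ≤-trans; m≤n⇒m≤1+n; m≤m+n; m≤n+m; +-suc; +-comm; +-monoʳ-≤; suc-injective; n<1+n; <-irrefl; m+1+n≰m; m≤n⇒m<n∨m≡n)
import Data.Fin
open import Data.Fin using (Fin)
open import Data.Bool using (Bool; true; false; _∧_; _∨_; if_then_else_; T; T?)
open import Data.Bool.ListAction using (any)
open import Data.Bool.Properties using (∨-assoc; ∨-comm; ∨-zeroʳ; ∨-conicalˡ; ∨-conicalʳ)
open import Data.List using (List; []; _∷_; _++_; _∷ʳ_; map; length; allFin; initLast; _∷ʳ′_)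
open import Data.List.Properties using (map-∘; length-tabulate; ++-assoc; ++-identityʳ; ++-conicalʳ; length-++; length-map; map-++; ∷-injectiveˡ; ∷-injectiveʳ; ≡-dec)
open import Data.List.Membership.Propositional using (_∈_)
open import Data.List.Membership.Propositional.Properties using (∈-allFin; ∈-filter⁺; ∈-filter⁻)
open import Data.List.Relation.Unary.Any using (here; there)
open import Data.List.Relation.Unary.All as All using (All; []; _∷_)
open import Data.List.Relation.Unary.All.Properties as All using (++⁺; ++⁻ˡ; ∷ʳ⁺; ∷ʳ⁻)
open import Data.List.Relation.Unary.Unique.Propositional using (Unique)
import Data.List.Relation.Unary.Unique.Propositional.Properties as Unique
open import Data.List.Relation.Unary.AllPairs using ([]; _∷_)
open import Data.Product using (Σ; ∃; _×_; _,_; proj₁; proj₂)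
open import Data.Sum using (_⊎_; inj₁; inj₂)
open import Data.Maybe using (just; nothing)
open import Data.Empty using (⊥-elim)
open import Function using (case_of_; mk⇔)
open import Relation.Nullary using (¬_; Dec; yes; no; does)
open import Relation.Nullary.Decidable using (_⊎-dec_; _→-dec_; dec-true; dec-false; does-⇔)
open import Relation.Binary.Definitions using (DecidableEquality)
open import Relation.Binary.PropositionalEquality
open import Data.Fin.Properties using (all?; ¬∀⟶∃¬)
open import Data.List.Relation.Binary.Permutation.Propositional as Perm using (_↭_; ↭-refl; ↭-trans; ↭-sym; ↭-reflexive)
import Data.List.Relation.Binary.Permutation.Propositional.Properties as Perm

does⇒ : ∀ {P : Set} (d : Dec P) → does d ≡ true → P
does⇒ (yes p) _ = p

does⇒¬ : ∀ {P : Set} (d : Dec P) → does d ≡ false → ¬ P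
does⇒¬ (no ¬p) _ = ¬p

∨-introˡ : ∀ {a} b → a ≡ true → a ∨ b ≡ true
∨-introˡ b refl = refl

∨-introʳ : ∀ a {b} → b ≡ true → a ∨ b ≡ true
∨-introʳ true  _ = refl
∨-introʳ false p = p

∨-elim : ∀ a {b} → a ∨ b ≡ true → a ≡ true ⊎ b ≡ true
∨-elim true  _ = inj₁ refl
∨-elim false p = inj₂ p

∨-false : ∀ a {b} → a ∨ b ≡ false → a ≡ false × b ≡ false
∨-false a {b} p = ∨-conicalˡ a b p , ∨-conicalʳ a b p

if-cong : ∀ {A : Set} {b b' : Bool} {p p' q q' : A} → b ≡ b' → p ≡ p' → q ≡ q' →
          (if b then p else q) ≡ (if b' then p' else q')
if-cong refl refl refl = refl

∷ʳ≢[] : ∀ {A : Set} (q : List A) v → q ∷ʳ v ≢ []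
∷ʳ≢[] q v e = case ++-conicalʳ q (v ∷ []) e of λ ()

map-const : ∀ {A : Set} {c : A} w → All (_≡ c) w → map (λ _ → c) w ≡ w
map-const []      []          = refl
map-const (_ ∷ w) (refl ∷ ps) = cong (_ ∷_) (map-const w ps)

map-const-length : ∀ {A B : Set} {c : B} (w w' : List A) → length w ≡ length w' → map (λ _ → c) w ≡ map (λ _ → c) w'
map-const-length []      []       e = refl
map-const-length (_ ∷ w) (_ ∷ w') e = cong (_ ∷_) (map-const-length w w' (suc-injective e))

All-last : ∀ {A : Set} {P : A → Set} {q v} → All P (q ∷ʳ v) → P v
All-last ps = proj₂ (∷ʳ⁻ ps)

length-∷ʳ≤ : ∀ {A : Set} {m} (q : List A) v → length (q ∷ʳ v) ≤ suc m → length q ≤ m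
length-∷ʳ≤ q v lw = s≤s⁻¹ (subst (_≤ _) (trans (length-++ q) (+-comm (length q) 1)) lw)

dropLast : ∀ {A : Set} → List A → List A
dropLast []           = []
dropLast (x ∷ [])     = []
dropLast (x ∷ y ∷ xs) = x ∷ dropLast (y ∷ xs)

dropLast-∷ʳ : ∀ {A : Set} (q : List A) v → dropLast (q ∷ʳ v) ≡ q
dropLast-∷ʳ []          v = refl
dropLast-∷ʳ (x ∷ [])    v = refl
dropLast-∷ʳ (x ∷ y ∷ q) v = cong (x ∷_) (dropLast-∷ʳ (y ∷ q) v)

module PartiallyCommutative {V : Set} (_≟_ : DecidableEquality V) (Adj : V → V → Set)
         (adj? : ∀ a b → Dec (Adj a b)) (adj-sym : ∀ {a b} → Adj a b → Adj b a) where

  open PartComm Adj public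

  ≡⇒≈ : ∀ {w w'} → w ≡ w' → w ≈ w'
  ≡⇒≈ refl = ≈-refl

  ≈-congˡ : ∀ p {w w'} → w ≈ w' → (p ++ w) ≈ (p ++ w')
  ≈-congˡ p ≈-refl          = ≈-refl
  ≈-congˡ p (≈-sym e)       = ≈-sym (≈-congˡ p e)
  ≈-congˡ p (≈-trans e f)   = ≈-trans (≈-congˡ p e) (≈-congˡ p f)
  ≈-congˡ p (≈-swap xs ys a b a≢b ¬ab) =
    subst₂ _≈_ (++-assoc p xs (a ∷ b ∷ ys)) (++-assoc p xs (b ∷ a ∷ ys)) (≈-swap (p ++ xs) ys a b a≢b ¬ab)

  ≈-congʳ : ∀ s {w w'} → w ≈ w' → (w ++ s) ≈ (w' ++ s)
  ≈-congʳ s ≈-refl          = ≈-refl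
  ≈-congʳ s (≈-sym e)       = ≈-sym (≈-congʳ s e)
  ≈-congʳ s (≈-trans e f)   = ≈-trans (≈-congʳ s e) (≈-congʳ s f)
  ≈-congʳ s (≈-swap xs ys a b a≢b ¬ab) =
    subst₂ _≈_ (sym (++-assoc xs (a ∷ b ∷ ys) s)) (sym (++-assoc xs (b ∷ a ∷ ys) s)) (≈-swap xs (ys ++ s) a b a≢b ¬ab)

  ≈-++ : ∀ {a a' b b'} → a ≈ a' → b ≈ b' → (a ++ b) ≈ (a' ++ b')
  ≈-++ {a' = a'} {b = b} e f = ≈-trans (≈-congʳ b e) (≈-congˡ a' f)

  ≈⇒↭ : ∀ {w w'} → w ≈ w' → w ↭ w'
  ≈⇒↭ ≈-refl                    = ↭-refl
  ≈⇒↭ (≈-sym e)                 = ↭-sym (≈⇒↭ e)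
  ≈⇒↭ (≈-trans e f)             = ↭-trans (≈⇒↭ e) (≈⇒↭ f)
  ≈⇒↭ (≈-swap xs ys a b _ _)    = Perm.++⁺ˡ xs (Perm.swap a b ↭-refl)

  ≈-length : ∀ {w w'} → w ≈ w' → length w ≡ length w'
  ≈-length e = Perm.↭-length (≈⇒↭ e)

  ≈[]⇒≡[] : ∀ {w} → w ≈ [] → w ≡ []
  ≈[]⇒≡[] {[]}    e = refl
  ≈[]⇒≡[] {x ∷ w} e = case ≈-length e of λ ()

  swap-last : ∀ Y z e u → e ≢ u → ¬ Adj e u → ((Y ++ (z ∷ʳ e)) ∷ʳ u) ≈ (((Y ++ z) ∷ʳ u) ∷ʳ e)
  swap-last Y z e u e≢u ¬eu = subst₂ _≈_ (sym l) (sym r) (≈-swap (Y ++ z) [] e u e≢u ¬eu)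
    where
    l : ((Y ++ (z ∷ʳ e)) ∷ʳ u) ≡ (Y ++ z) ++ e ∷ u ∷ []
    l = trans (cong (_∷ʳ u) (sym (++-assoc Y z (e ∷ [])))) (++-assoc (Y ++ z) (e ∷ []) (u ∷ []))
    r : (((Y ++ z) ∷ʳ u) ∷ʳ e) ≡ (Y ++ z) ++ u ∷ e ∷ []
    r = ++-assoc (Y ++ z) (u ∷ []) (e ∷ [])

  Dependent : V → V → Set
  Dependent a b = a ≡ b ⊎ Adj a b

  dependent? : ∀ a b → Dec (Dependent a b)
  dependent? a b = (a ≟ b) ⊎-dec (adj? a b)

  dep : V → V → Bool
  dep a b = does (dependent? a b)

  dep-sym : ∀ a b → dep a b ≡ dep b a
  dep-sym a b = does-⇔ (mk⇔ flip flip) (dependent? a b) (dependent? b a)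
    where
    flip : ∀ {a b} → Dependent a b → Dependent b a
    flip (inj₁ e) = inj₁ (sym e)
    flip (inj₂ x) = inj₂ (adj-sym x)

  independent : ∀ {a b} → dep a b ≡ false → (a ≢ b) × ¬ Adj a b
  independent {a} {b} p = (λ e → does⇒¬ (dependent? a b) p (inj₁ e)) , (λ x → does⇒¬ (dependent? a b) p (inj₂ x))

  independent⇒dep≡false : ∀ {a b} → a ≢ b → ¬ Adj a b → dep a b ≡ false
  independent⇒dep≡false {a} {b} a≢b ¬ab = dec-false (dependent? a b) λ { (inj₁ e) → a≢b e ; (inj₂ x) → ¬ab x }

  dependsOnAny : V → List V → Bool
  dependsOnAny c []      = false
  dependsOnAny c (e ∷ L) = dep c e ∨ dependsOnAny c L

  dependsOnAny-++ : ∀ c A B → dependsOnAny c (A ++ B) ≡ dependsOnAny c A ∨ dependsOnAny c B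
  dependsOnAny-++ c []      B = refl
  dependsOnAny-++ c (e ∷ A) B =
    trans (cong (dep c e ∨_) (dependsOnAny-++ c A B)) (sym (∨-assoc (dep c e) (dependsOnAny c A) (dependsOnAny c B)))

  dependsOnAny-++ˡ : ∀ c A B → dependsOnAny c A ≡ true → dependsOnAny c (A ++ B) ≡ true
  dependsOnAny-++ˡ c A B p rewrite dependsOnAny-++ c A B | p = refl

  dependsOnAny-++ʳ : ∀ c A {B} → dependsOnAny c B ≡ true → dependsOnAny c (A ++ B) ≡ true
  dependsOnAny-++ʳ c A {B} p rewrite dependsOnAny-++ c A B = ∨-introʳ (dependsOnAny c A) p

  dependsOnAny-false : ∀ c L → dependsOnAny c L ≡ false → All (λ e → dep c e ≡ false) L
  dependsOnAny-false c []      p = []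
  dependsOnAny-false c (e ∷ L) p = proj₁ (∨-false (dep c e) p) ∷ dependsOnAny-false c L (proj₂ (∨-false (dep c e) p))

  dependsOnAny-true : ∀ {C : V → Set} c L → dependsOnAny c L ≡ true → All C L → ∃ λ e → dep c e ≡ true × C e
  dependsOnAny-true c (e ∷ L) p (q ∷ qs) with ∨-elim (dep c e) p
  ... | inj₁ d = e , d , q
  ... | inj₂ r = dependsOnAny-true c L r qs

  dependsOnAny-swap : ∀ c a b X → dependsOnAny c (a ∷ b ∷ X) ≡ dependsOnAny c (b ∷ a ∷ X)
  dependsOnAny-swap c a b X = begin
    dep c a ∨ (dep c b ∨ X')   ≡⟨ sym (∨-assoc (dep c a) (dep c b) X') ⟩
    (dep c a ∨ dep c b) ∨ X'   ≡⟨ cong (_∨ X') (∨-comm (dep c a) (dep c b)) ⟩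
    (dep c b ∨ dep c a) ∨ X'   ≡⟨ ∨-assoc (dep c b) (dep c a) X' ⟩
    dep c b ∨ (dep c a ∨ X')   ∎
    where
    open ≡-Reasoning
    X' = dependsOnAny c X

  commute : ∀ c d r → All (λ e → dep c e ≡ false) d → (c ∷ d ++ r) ≈ (d ++ c ∷ r)
  commute c []      r []       = ≈-refl
  commute c (e ∷ d) r (p ∷ ps) =
    ≈-trans (≈-swap [] (d ++ r) c e (proj₁ (independent p)) (proj₂ (independent p))) (≈-congˡ (e ∷ []) (commute c d r ps))

  -- under x ctx w: the letters of w lying below an occurrence of x in w, or below a letter of ctx placed after w.
  reaches : V → V → List V → Bool
  reaches x c L = does (c ≟ x) ∨ dependsOnAny c L

  under beside : V → List V → List V → List V
  under x ctx []      = []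
  under x ctx (c ∷ w) = if reaches x c (under x ctx w ++ ctx) then c ∷ under x ctx w else under x ctx w
  beside x ctx []      = []
  beside x ctx (c ∷ w) = if reaches x c (under x ctx w ++ ctx) then beside x ctx w else c ∷ beside x ctx w

  Pyramid : V → List V → Set
  Pyramid x w = beside x [] w ≡ []

  reaches-self : ∀ x L → reaches x x L ≡ true
  reaches-self x L rewrite dec-true (x ≟ x) refl = refl

  reaches-skip : ∀ x c e L → dep c e ≡ false → reaches x c (e ∷ L) ≡ reaches x c L
  reaches-skip x c e L p rewrite p = refl

  reaches-mono : ∀ x c ctx s → reaches x c ctx ≡ true → reaches x c (s ++ ctx) ≡ true
  reaches-mono x c ctx s g with ∨-elim (does (c ≟ x)) g
  ... | inj₁ p = ∨-introˡ _ p
  ... | inj₂ p = ∨-introʳ (does (c ≟ x)) (dependsOnAny-++ʳ c s p)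

  reaches-false : ∀ x c D ctx → reaches x c (D ++ ctx) ≡ false → dependsOnAny c D ≡ false
  reaches-false x c D ctx p rewrite dependsOnAny-++ c D ctx = ∨-conicalˡ _ _ (proj₂ (∨-false (does (c ≟ x)) p))

  ≈-under++beside : ∀ x ctx w → w ≈ (under x ctx w ++ beside x ctx w)
  ≈-under++beside x ctx []      = ≈-refl
  ≈-under++beside x ctx (c ∷ w) with reaches x c (under x ctx w ++ ctx) in eq
  ... | true  = ≈-congˡ (c ∷ []) (≈-under++beside x ctx w)
  ... | false = ≈-trans (≈-congˡ (c ∷ []) (≈-under++beside x ctx w))
      (commute c (under x ctx w) (beside x ctx w) (dependsOnAny-false c _ (reaches-false x c (under x ctx w) ctx eq)))

  split-cong-ctx : ∀ x {ctx ctx'} → (∀ c → dependsOnAny c ctx ≡ dependsOnAny c ctx') → ∀ w →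
                   under x ctx w ≡ under x ctx' w × beside x ctx w ≡ beside x ctx' w
  split-cong-ctx x h []      = refl , refl
  split-cong-ctx x {ctx} {ctx'} h (c ∷ w) = if-cong same (cong (c ∷_) d) d , if-cong same r (cong (c ∷_) r)
    where
    d = proj₁ (split-cong-ctx x h w)
    r = proj₂ (split-cong-ctx x h w)
    D = under x ctx w
    same : reaches x c (D ++ ctx) ≡ reaches x c (under x ctx' w ++ ctx')
    same = cong (does (c ≟ x) ∨_) (begin
      dependsOnAny c (D ++ ctx)                    ≡⟨ dependsOnAny-++ c D ctx ⟩
      dependsOnAny c D ∨ dependsOnAny c ctx        ≡⟨ cong (dependsOnAny c D ∨_) (h c) ⟩
      dependsOnAny c D ∨ dependsOnAny c ctx'       ≡⟨ sym (dependsOnAny-++ c D ctx') ⟩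
      dependsOnAny c (D ++ ctx')                   ≡⟨ cong (λ D' → dependsOnAny c (D' ++ ctx')) d ⟩
      dependsOnAny c (under x ctx' w ++ ctx')      ∎)
      where open ≡-Reasoning

  split-++ : ∀ x ctx xs zs →
    (under x ctx (xs ++ zs) ≡ under x (under x ctx zs ++ ctx) xs ++ under x ctx zs) ×
    (beside x ctx (xs ++ zs) ≡ beside x (under x ctx zs ++ ctx) xs ++ beside x ctx zs)
  split-++ x ctx []       zs = refl , refl
  split-++ x ctx (c ∷ xs) zs
    rewrite proj₁ (split-++ x ctx xs zs) | proj₂ (split-++ x ctx xs zs)
          | ++-assoc (under x (under x ctx zs ++ ctx) xs) (under x ctx zs) ctx
    with reaches x c (under x (under x ctx zs ++ ctx) xs ++ under x ctx zs ++ ctx)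
  ... | true  = refl , refl
  ... | false = refl , refl

  split-swap : ∀ x ctx a b ys → dep a b ≡ false → dep b a ≡ false →
    (under x ctx (a ∷ b ∷ ys) ≈ under x ctx (b ∷ a ∷ ys)) ×
    (beside x ctx (a ∷ b ∷ ys) ≈ beside x ctx (b ∷ a ∷ ys)) ×
    (∀ c → dependsOnAny c (under x ctx (a ∷ b ∷ ys) ++ ctx) ≡ dependsOnAny c (under x ctx (b ∷ a ∷ ys) ++ ctx))
  split-swap x ctx a b ys pab pba
    with reaches x a (under x ctx ys ++ ctx) in ea | reaches x b (under x ctx ys ++ ctx) in eb
  ... | true | true
    rewrite trans (reaches-skip x a b (under x ctx ys ++ ctx) pab) ea
          | trans (reaches-skip x b a (under x ctx ys ++ ctx) pba) eb
    = ≈-swap [] (under x ctx ys) a b (proj₁ (independent pab)) (proj₂ (independent pab)) , ≈-refl ,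
      λ c → dependsOnAny-swap c a b (under x ctx ys ++ ctx)
  ... | true | false
    rewrite ea | trans (reaches-skip x b a (under x ctx ys ++ ctx) pba) eb = ≈-refl , ≈-refl , λ c → refl
  ... | false | true
    rewrite eb | trans (reaches-skip x a b (under x ctx ys ++ ctx) pab) ea = ≈-refl , ≈-refl , λ c → refl
  ... | false | false
    rewrite ea | eb
    = ≈-refl , ≈-swap [] (beside x ctx ys) a b (proj₁ (independent pab)) (proj₂ (independent pab)) , λ c → refl

  split-resp-≈ : ∀ x ctx {w w'} → w ≈ w' → (under x ctx w ≈ under x ctx w') × (beside x ctx w ≈ beside x ctx w')
  split-resp-≈ x ctx ≈-refl        = ≈-refl , ≈-refl
  split-resp-≈ x ctx (≈-sym e)     = ≈-sym (proj₁ (split-resp-≈ x ctx e)) , ≈-sym (proj₂ (split-resp-≈ x ctx e))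
  split-resp-≈ x ctx (≈-trans e f) =
    ≈-trans (proj₁ (split-resp-≈ x ctx e)) (proj₁ (split-resp-≈ x ctx f)) ,
    ≈-trans (proj₂ (split-resp-≈ x ctx e)) (proj₂ (split-resp-≈ x ctx f))
  split-resp-≈ x ctx (≈-swap xs ys a b a≢b ¬ab)
    with split-swap x ctx a b ys (independent⇒dep≡false a≢b ¬ab)
                                 (trans (dep-sym b a) (independent⇒dep≡false a≢b ¬ab))
  ... | d , r , h =
    ≈-trans (≡⇒≈ (proj₁ P)) (≈-trans (≈-++ (≡⇒≈ (proj₁ (split-cong-ctx x h xs))) d) (≡⇒≈ (sym (proj₁ P')))) ,
    ≈-trans (≡⇒≈ (proj₂ P)) (≈-trans (≈-++ (≡⇒≈ (proj₂ (split-cong-ctx x h xs))) r) (≡⇒≈ (sym (proj₂ P'))))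
    where
    P  = split-++ x ctx xs (a ∷ b ∷ ys)
    P' = split-++ x ctx xs (b ∷ a ∷ ys)

  beside-avoids : ∀ x ctx w → All (_≢ x) (beside x ctx w)
  beside-avoids x ctx []      = []
  beside-avoids x ctx (c ∷ w) with reaches x c (under x ctx w ++ ctx) in eq
  ... | true  = beside-avoids x ctx w
  ... | false = does⇒¬ (c ≟ x) (proj₁ (∨-false (does (c ≟ x)) eq)) ∷ beside-avoids x ctx w

  All-under : ∀ {P : V → Set} x ctx {w} → All P w → All P (under x ctx w)
  All-under x ctx {[]}    []       = []
  All-under x ctx {c ∷ w} (p ∷ ps) with reaches x c (under x ctx w ++ ctx)
  ... | true  = p ∷ All-under x ctx ps
  ... | false = All-under x ctx ps

  All-beside : ∀ {P : V → Set} x ctx {w} → All P w → All P (beside x ctx w)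
  All-beside x ctx {[]}    []       = []
  All-beside x ctx {c ∷ w} (p ∷ ps) with reaches x c (under x ctx w ++ ctx)
  ... | true  = All-beside x ctx ps
  ... | false = p ∷ All-beside x ctx ps

  under-length : ∀ x ctx w → length (under x ctx w) + length (beside x ctx w) ≡ length w
  under-length x ctx w = trans (sym (length-++ (under x ctx w))) (sym (≈-length (≈-under++beside x ctx w)))

  under-length≤ : ∀ x ctx w → length (under x ctx w) ≤ length w
  under-length≤ x ctx w = ≤-trans (m≤m+n _ _) (≤-reflexive (under-length x ctx w))

  beside-length≤ : ∀ x ctx w → length (beside x ctx w) ≤ length w
  beside-length≤ x ctx w = ≤-trans (m≤n+m _ _) (≤-reflexive (under-length x ctx w))

  InP⇒Pyramid : ∀ x w → InP x w → Pyramid x w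
  InP⇒Pyramid x w h with beside x [] w in e
  ... | r with initLast r
  ...   | []      = refl
  ...   | q ∷ʳ′ v = ⊥-elim (All-last (subst (All (_≢ x)) e (beside-avoids x [] w)) (h v (under x [] w ++ q , ia)))
    where
    ia : w ≈ ((under x [] w ++ q) ∷ʳ v)
    ia = ≈-trans (≈-under++beside x [] w)
           (≡⇒≈ (trans (cong (under x [] w ++_) e) (sym (++-assoc (under x [] w) q (v ∷ [])))))

  Pyramid⇒InP : ∀ x w → Pyramid x w → InP x w
  Pyramid⇒InP x w pyr v (z , e) with v ≟ x
  ... | yes v≡x = v≡x
  ... | no  v≢x = ⊥-elim (∷ʳ≢[] _ v (trans (sym split-last) nothing-beside))
    where
    nothing-beside : beside x [] (z ∷ʳ v) ≡ []
    nothing-beside = ≈[]⇒≡[] (≈-trans (proj₂ (split-resp-≈ x [] (≈-sym e))) (≡⇒≈ pyr))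
    single : beside x [] (v ∷ []) ≡ v ∷ []
    single rewrite dec-false (v ≟ x) v≢x = refl
    split-last : beside x [] (z ∷ʳ v) ≡ beside x (under x [] (v ∷ []) ++ []) z ∷ʳ v
    split-last = trans (proj₂ (split-++ x [] z (v ∷ []))) (cong (beside x (under x [] (v ∷ []) ++ []) z ++_) single)

  pyramid-last : ∀ x z v → Pyramid x (z ∷ʳ v) → v ≡ x
  pyramid-last x z v pyr = Pyramid⇒InP x (z ∷ʳ v) pyr v (z , ≈-refl)

  beside≡[]⇒under≡id : ∀ x ctx s → beside x ctx s ≡ [] → under x ctx s ≡ s
  beside≡[]⇒under≡id x ctx []      p = refl
  beside≡[]⇒under≡id x ctx (c ∷ s) p with reaches x c (under x ctx s ++ ctx)
  ... | true  = cong (c ∷_) (beside≡[]⇒under≡id x ctx s p)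
  ... | false = case p of λ ()

  under-pyramid : ∀ x ctx w → beside x ctx (under x ctx w) ≡ []
  under-pyramid x ctx []      = refl
  under-pyramid x ctx (c ∷ w) with reaches x c (under x ctx w ++ ctx) in eq
  ... | false = under-pyramid x ctx w
  ... | true rewrite beside≡[]⇒under≡id x ctx (under x ctx w) (under-pyramid x ctx w) | eq = under-pyramid x ctx w

  all-x⇒beside≡[] : ∀ x ctx w → All (_≡ x) w → beside x ctx w ≡ []
  all-x⇒beside≡[] x ctx []      []           = refl
  all-x⇒beside≡[] x ctx (c ∷ w) (refl ∷ ps) rewrite dec-true (c ≟ c) refl = all-x⇒beside≡[] x ctx w ps

  pyramid-absorbed : ∀ x y ctx s → Pyramid y s → reaches x y ctx ≡ true →
                     under x ctx s ≡ s × beside x ctx s ≡ []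
  pyramid-absorbed x y ctx []      pyr g = refl , refl
  pyramid-absorbed x y ctx (c ∷ s) pyr g with reaches y c (under y [] s ++ []) in ey
  ... | false = case pyr of λ ()
  ... | true  = trans (if-true reached) (cong (c ∷_) (proj₁ IH)) , trans (if-true reached) (proj₂ IH)
    where
    IH = pyramid-absorbed x y ctx s pyr g
    if-true : ∀ {A : Set} {b : Bool} {p q : A} → b ≡ true → (if b then p else q) ≡ p
    if-true refl = refl
    c-reaches-y : does (c ≟ y) ∨ dependsOnAny c s ≡ true
    c-reaches-y = subst (λ D → does (c ≟ y) ∨ dependsOnAny c D ≡ true)
                        (trans (++-identityʳ _) (beside≡[]⇒under≡id y [] s pyr)) ey
    reached′ : reaches x c (s ++ ctx) ≡ true
    reached′ with ∨-elim (does (c ≟ y)) c-reaches-y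
    ... | inj₁ q = reaches-mono x c ctx s (subst (λ z → reaches x z ctx ≡ true) (sym (does⇒ (c ≟ y) q)) g)
    ... | inj₂ q = ∨-introʳ (does (c ≟ x)) (dependsOnAny-++ˡ c s ctx q)
    reached : reaches x c (under x ctx s ++ ctx) ≡ true
    reached = subst (λ D → reaches x c (D ++ ctx) ≡ true) (sym (proj₁ IH)) reached′

  absorbed-++ : ∀ x y ctx s B → Pyramid y s → reaches x y (B ++ ctx) ≡ true →
                under x ctx B ≡ B → beside x ctx B ≡ [] → under x ctx (s ++ B) ≡ s ++ B × beside x ctx (s ++ B) ≡ []
  absorbed-++ x y ctx s B pyr g dB rB =
    trans (proj₁ (split-++ x ctx s B)) (cong₂ _++_ (trans (cong (λ z → under x (z ++ ctx) s) dB) (proj₁ X)) dB) ,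
    trans (proj₂ (split-++ x ctx s B)) (cong₂ _++_ (trans (cong (λ z → beside x (z ++ ctx) s) dB) (proj₂ X)) rB)
    where X = pyramid-absorbed x y (B ++ ctx) s pyr g

  absorbed⇒pyramid-∷ʳ : ∀ x s → beside x (x ∷ []) s ≡ [] → Pyramid x (s ∷ʳ x)
  absorbed⇒pyramid-∷ʳ x s h rewrite proj₂ (split-++ x [] s (x ∷ [])) | dec-true (x ≟ x) refl = cong (_++ []) h

  avoiding-split : ∀ x B → All (_≢ x) B → under x [] B ≡ [] × beside x [] B ≡ B
  avoiding-split x []      []           = refl , refl
  avoiding-split x (c ∷ B) (c≢x ∷ nes) with avoiding-split x B nes
  ... | d , r rewrite d | dec-false (c ≟ x) c≢x = refl , cong (c ∷_) r

  pyramid++avoiding-split : ∀ x s B → Pyramid x s → All (_≢ x) B → under x [] (s ++ B) ≡ s × beside x [] (s ++ B) ≡ B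
  pyramid++avoiding-split x s B pyr nb with avoiding-split x B nb
  ... | d , r =
    trans (proj₁ (split-++ x [] s B))
      (trans (cong₂ _++_ (cong (λ z → under x (z ++ []) s) d) d)
        (trans (++-identityʳ _) (beside≡[]⇒under≡id x [] s pyr))) ,
    trans (proj₂ (split-++ x [] s B)) (cong₂ _++_ (trans (cong (λ z → beside x (z ++ []) s) d) pyr) r)

  data Chain (Q : V → Set) (x : V) : V → Set where
    base : Chain Q x x
    step : ∀ {e e'} → Q e → dep e e' ≡ true → Chain Q x e' → Chain Q x e

  under-chain : ∀ {Q : V → Set} x ctx {w} → All Q w → All (Chain Q x) ctx → All (Chain Q x) (under x ctx w)
  under-chain x ctx {[]}    []       cs = []
  under-chain {Q} x ctx {c ∷ w} (q ∷ qs) cs with reaches x c (under x ctx w ++ ctx) in eq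
  ... | false = under-chain x ctx qs cs
  ... | true  = chain ∷ IH
    where
    IH = under-chain x ctx qs cs
    chain : Chain Q x c
    chain with ∨-elim (does (c ≟ x)) eq
    ... | inj₁ p = subst (Chain Q x) (sym (does⇒ (c ≟ x) p)) base
    ... | inj₂ p with dependsOnAny-true c (under x ctx w ++ ctx) p (++⁺ IH cs)
    ...   | e , d , ce = step q d ce

  occurs : V → List V → Bool
  occurs a []      = false
  occurs a (c ∷ w) = does (c ≟ a) ∨ occurs a w

  deleteLast : V → List V → List V
  deleteLast a []      = []
  deleteLast a (c ∷ w) = if occurs a w then c ∷ deleteLast a w else (if does (c ≟ a) then w else c ∷ w)

  occurs-++ʳ : ∀ a xs zs → occurs a zs ≡ true → occurs a (xs ++ zs) ≡ true
  occurs-++ʳ a []       zs p = p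
  occurs-++ʳ a (x ∷ xs) zs p = ∨-introʳ (does (x ≟ a)) (occurs-++ʳ a xs zs p)

  occurs-++ˡ : ∀ a xs zs → occurs a xs ≡ true → occurs a (xs ++ zs) ≡ true
  occurs-++ˡ a (x ∷ xs) zs p with ∨-elim (does (x ≟ a)) p
  ... | inj₁ q rewrite q = refl
  ... | inj₂ q = ∨-introʳ (does (x ≟ a)) (occurs-++ˡ a xs zs q)

  occurs-++-false : ∀ a xs zs → occurs a xs ≡ false → occurs a (xs ++ zs) ≡ occurs a zs
  occurs-++-false a []       zs p = refl
  occurs-++-false a (x ∷ xs) zs p rewrite proj₁ (∨-false (does (x ≟ a)) p) = occurs-++-false a xs zs (proj₂ (∨-false (does (x ≟ a)) p))

  occurs-head : ∀ a ys → occurs a (a ∷ ys) ≡ true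
  occurs-head a ys rewrite dec-true (a ≟ a) refl = refl

  deleteLast-absent : ∀ a zs → occurs a zs ≡ false → deleteLast a zs ≡ zs
  deleteLast-absent a []       _ = refl
  deleteLast-absent a (z ∷ zs) q with ∨-false (does (z ≟ a)) q
  ... | q₁ , q₂ rewrite q₁ | q₂ = refl

  deleteLast-++ʳ : ∀ a xs zs → occurs a zs ≡ true → deleteLast a (xs ++ zs) ≡ xs ++ deleteLast a zs
  deleteLast-++ʳ a []       zs p = refl
  deleteLast-++ʳ a (x ∷ xs) zs p rewrite occurs-++ʳ a xs zs p = cong (x ∷_) (deleteLast-++ʳ a xs zs p)

  deleteLast-++ˡ : ∀ a xs zs → occurs a zs ≡ false → deleteLast a (xs ++ zs) ≡ deleteLast a xs ++ zs
  deleteLast-++ˡ a []       zs p = deleteLast-absent a zs p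
  deleteLast-++ˡ a (x ∷ xs) zs p with occurs a xs in eo
  ... | true rewrite occurs-++ˡ a xs zs eo = cong (x ∷_) (deleteLast-++ˡ a xs zs p)
  ... | false rewrite occurs-++-false a xs zs eo | p with does (x ≟ a)
  ...   | true  = refl
  ...   | false = refl

  deleteLast-swap-last : ∀ a xs c ys → occurs a ys ≡ false → c ≢ a →
                         deleteLast a (xs ++ a ∷ c ∷ ys) ≈ deleteLast a (xs ++ c ∷ a ∷ ys)
  deleteLast-swap-last a xs c ys p c≢a = ≡⇒≈ (begin
    deleteLast a (xs ++ a ∷ c ∷ ys)   ≡⟨ deleteLast-++ʳ a xs _ (occurs-head a (c ∷ ys)) ⟩
    xs ++ deleteLast a (a ∷ c ∷ ys)   ≡⟨ cong (xs ++_) a-first ⟩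
    xs ++ c ∷ ys                      ≡⟨ cong (xs ++_) (sym c-first) ⟩
    xs ++ deleteLast a (c ∷ a ∷ ys)   ≡⟨ sym (deleteLast-++ʳ a xs _ (∨-introʳ (does (c ≟ a)) (occurs-head a ys))) ⟩
    deleteLast a (xs ++ c ∷ a ∷ ys)   ∎)
    where
    open ≡-Reasoning
    a-first : deleteLast a (a ∷ c ∷ ys) ≡ c ∷ ys
    a-first rewrite p | dec-false (c ≟ a) c≢a | dec-true (a ≟ a) refl = refl
    c-first : deleteLast a (c ∷ a ∷ ys) ≡ c ∷ ys
    c-first rewrite p | dec-true (a ≟ a) refl = refl

  deleteLast-resp-≈ : ∀ a {w w'} → w ≈ w' → deleteLast a w ≈ deleteLast a w'
  deleteLast-resp-≈ a ≈-refl        = ≈-refl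
  deleteLast-resp-≈ a (≈-sym e)     = ≈-sym (deleteLast-resp-≈ a e)
  deleteLast-resp-≈ a (≈-trans e f) = ≈-trans (deleteLast-resp-≈ a e) (deleteLast-resp-≈ a f)
  deleteLast-resp-≈ a (≈-swap xs ys b c b≢c ¬bc) with occurs a ys in eys
  ... | true rewrite deleteLast-++ʳ a xs (b ∷ c ∷ ys) (occurs-++ʳ a (b ∷ c ∷ []) ys eys)
                   | deleteLast-++ʳ a xs (c ∷ b ∷ ys) (occurs-++ʳ a (c ∷ b ∷ []) ys eys)
                   | eys | ∨-zeroʳ (does (b ≟ a)) | ∨-zeroʳ (does (c ≟ a))
    = ≈-swap xs (deleteLast a ys) b c b≢c ¬bc
  ... | false with b ≟ a | c ≟ a
  ...   | yes refl | _        = deleteLast-swap-last a xs c ys eys (λ e → b≢c (sym e))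
  ...   | no b≢a   | yes refl = ≈-sym (deleteLast-swap-last a xs b ys eys b≢a)
  ...   | no b≢a   | no c≢a   =
    ≈-trans (≡⇒≈ (deleteLast-++ˡ a xs _ (absent b c b≢a c≢a)))
      (≈-trans (≈-swap (deleteLast a xs) ys b c b≢c ¬bc) (≡⇒≈ (sym (deleteLast-++ˡ a xs _ (absent c b c≢a b≢a)))))
    where
    absent : ∀ d e → d ≢ a → e ≢ a → occurs a (d ∷ e ∷ ys) ≡ false
    absent d e d≢a e≢a rewrite dec-false (d ≟ a) d≢a | dec-false (e ≟ a) e≢a = eys

  ∷ʳ-cancelʳ : ∀ a {q q'} → (q ∷ʳ a) ≈ (q' ∷ʳ a) → q ≈ q'
  ∷ʳ-cancelʳ a {q} {q'} e = subst₂ _≈_ (deleteLast-∷ʳ q) (deleteLast-∷ʳ q') (deleteLast-resp-≈ a e)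
    where
    deleteLast-∷ʳ : ∀ q → deleteLast a (q ∷ʳ a) ≡ q
    deleteLast-∷ʳ q rewrite deleteLast-++ʳ a q (a ∷ []) (occurs-head a []) | dec-true (a ≟ a) refl = ++-identityʳ q

_≟ₐ_ : DecidableEquality Addr
_≟ₐ_ = ≡-dec Data.Nat._≟_

IsChild : Addr → Addr → Set
IsChild a b = ∃ λ i → b ≡ a ∷ʳ i

isChild? : ∀ a b → Dec (IsChild a b)
isChild? []      []          = no λ { (i , ()) }
isChild? []      (j ∷ [])    = yes (j , refl)
isChild? []      (j ∷ k ∷ b) = no λ { (i , ()) }
isChild? (x ∷ a) []          = no λ { (i , ()) }
isChild? (x ∷ a) (y ∷ b) with x Data.Nat.≟ y | isChild? a b
... | yes refl | yes (i , refl) = yes (i , refl)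
... | yes refl | no ¬p          = no λ { (i , e) → ¬p (i , ∷-injectiveʳ e) }
... | no x≢y   | _              = no λ { (i , e) → x≢y (sym (∷-injectiveˡ e)) }

treeAdj? : ∀ a b → Dec (TreeAdj a b)
treeAdj? a b = isChild? a b ⊎-dec isChild? b a

treeAdj-sym : ∀ {a b} → TreeAdj a b → TreeAdj b a
treeAdj-sym (inj₁ x) = inj₂ x
treeAdj-sym (inj₂ y) = inj₁ y

module T = PartiallyCommutative _≟ₐ_ TreeAdj treeAdj? treeAdj-sym
open T using (≈-refl; ≈-sym; ≈-trans; ≈-swap)

TreeAdj-∷⁻ : ∀ i {a b} → TreeAdj (i ∷ a) (i ∷ b) → TreeAdj a b
TreeAdj-∷⁻ i (inj₁ (j , e)) = inj₁ (j , ∷-injectiveʳ e)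
TreeAdj-∷⁻ i (inj₂ (j , e)) = inj₂ (j , ∷-injectiveʳ e)

TreeAdj-∷⁺ : ∀ i {a b} → TreeAdj a b → TreeAdj (i ∷ a) (i ∷ b)
TreeAdj-∷⁺ i (inj₁ (j , e)) = inj₁ (j , cong (i ∷_) e)
TreeAdj-∷⁺ i (inj₂ (j , e)) = inj₂ (j , cong (i ∷_) e)

prefix-≈ : ∀ i {w w'} → w T.≈ w' → map (i ∷_) w T.≈ map (i ∷_) w'
prefix-≈ i ≈-refl        = ≈-refl
prefix-≈ i (≈-sym e)     = ≈-sym (prefix-≈ i e)
prefix-≈ i (≈-trans e f) = ≈-trans (prefix-≈ i e) (prefix-≈ i f)
prefix-≈ i (≈-swap xs ys a b a≢b ¬ab) =
  subst₂ T._≈_ (sym (map-++ (i ∷_) xs (a ∷ b ∷ ys))) (sym (map-++ (i ∷_) xs (b ∷ a ∷ ys)))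
    (≈-swap (map (i ∷_) xs) (map (i ∷_) ys) (i ∷ a) (i ∷ b) (λ e → a≢b (∷-injectiveʳ e)) (λ t → ¬ab (TreeAdj-∷⁻ i t)))

inSubtreeᵇ : ℕ → Addr → Bool
inSubtreeᵇ i []      = false
inSubtreeᵇ i (j ∷ a) = does (i Data.Nat.≟ j)

drop₁ : Addr → Addr
drop₁ []      = []
drop₁ (j ∷ a) = a

restrict : ℕ → List Addr → List Addr
restrict i []      = []
restrict i (v ∷ w) = if inSubtreeᵇ i v then drop₁ v ∷ restrict i w else restrict i w

inSubtreeᵇ⇒ : ∀ i v → inSubtreeᵇ i v ≡ true → v ≡ i ∷ drop₁ v
inSubtreeᵇ⇒ i (j ∷ a) p = cong (_∷ a) (sym (does⇒ (i Data.Nat.≟ j) p))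

restrict-++ : ∀ i xs ys → restrict i (xs ++ ys) ≡ restrict i xs ++ restrict i ys
restrict-++ i []       ys = refl
restrict-++ i (v ∷ xs) ys with inSubtreeᵇ i v
... | true  = cong (drop₁ v ∷_) (restrict-++ i xs ys)
... | false = restrict-++ i xs ys

restrict-≈ : ∀ i {w w'} → w T.≈ w' → restrict i w T.≈ restrict i w'
restrict-≈ i ≈-refl        = ≈-refl
restrict-≈ i (≈-sym e)     = ≈-sym (restrict-≈ i e)
restrict-≈ i (≈-trans e f) = ≈-trans (restrict-≈ i e) (restrict-≈ i f)
restrict-≈ i (≈-swap xs ys a b a≢b ¬ab)
  rewrite restrict-++ i xs (a ∷ b ∷ ys) | restrict-++ i xs (b ∷ a ∷ ys)
  with inSubtreeᵇ i a in ea | inSubtreeᵇ i b in eb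
... | true  | true  = ≈-swap (restrict i xs) (restrict i ys) (drop₁ a) (drop₁ b)
       (λ e → a≢b (trans (inSubtreeᵇ⇒ i a ea) (trans (cong (i ∷_) e) (sym (inSubtreeᵇ⇒ i b eb)))))
       (λ t → ¬ab (subst₂ TreeAdj (sym (inSubtreeᵇ⇒ i a ea)) (sym (inSubtreeᵇ⇒ i b eb)) (TreeAdj-∷⁺ i t)))
... | true  | false = ≈-refl
... | false | true  = ≈-refl
... | false | false = ≈-refl

restrict-prefix : ∀ i P → restrict i (map (i ∷_) P) ≡ P
restrict-prefix i []      = refl
restrict-prefix i (a ∷ P) rewrite dec-true (i Data.Nat.≟ i) refl = cong (a ∷_) (restrict-prefix i P)

restrict-otherPrefix : ∀ i j P → i ≢ j → restrict i (map (j ∷_) P) ≡ []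
restrict-otherPrefix i j []      i≢j = refl
restrict-otherPrefix i j (a ∷ P) i≢j rewrite dec-false (i Data.Nat.≟ j) i≢j = restrict-otherPrefix i j P i≢j

restrict-length≤ : ∀ i L → length (restrict i L) ≤ length L
restrict-length≤ i []      = z≤n
restrict-length≤ i (v ∷ L) with inSubtreeᵇ i v
... | true  = s≤s (restrict-length≤ i L)
... | false = m≤n⇒m≤1+n (restrict-length≤ i L)

chain-inSubtree : ∀ i {e} → T.Chain (_≢ []) (i ∷ []) e → ∃ λ b → e ≡ i ∷ b
chain-inSubtree i T.base = [] , refl
chain-inSubtree i (T.step {e} {e'} e≢[] d ch) with chain-inSubtree i ch | does⇒ (T.dependent? e e') d
... | b , refl | inj₁ refl               = b , refl
... | b , refl | inj₂ (inj₂ (j , eq))    = b ∷ʳ j , eq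
... | b , refl | inj₂ (inj₁ (j , eq)) with e
...   | []     = ⊥-elim (e≢[] refl)
...   | y ∷ e₀ = e₀ , cong (_∷ e₀) (sym (∷-injectiveˡ eq))

dep-prefix : ∀ i a b → T.dep (i ∷ a) (i ∷ b) ≡ T.dep a b
dep-prefix i a b = does-⇔
  (mk⇔ (λ { (inj₁ e) → inj₁ (∷-injectiveʳ e) ; (inj₂ t) → inj₂ (TreeAdj-∷⁻ i t) })
       (λ { (inj₁ e) → inj₁ (cong (i ∷_) e) ; (inj₂ t) → inj₂ (TreeAdj-∷⁺ i t) }))
  (T.dependent? (i ∷ a) (i ∷ b)) (T.dependent? a b)

dependsOnAny-prefix : ∀ i c L → T.dependsOnAny (i ∷ c) (map (i ∷_) L) ≡ T.dependsOnAny c L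
dependsOnAny-prefix i c []      = refl
dependsOnAny-prefix i c (e ∷ L) rewrite dep-prefix i c e | dependsOnAny-prefix i c L = refl

reaches-prefix : ∀ i x c L → T.reaches (i ∷ x) (i ∷ c) (map (i ∷_) L) ≡ T.reaches x c L
reaches-prefix i x c L rewrite dependsOnAny-prefix i c L
  | does-⇔ (mk⇔ ∷-injectiveʳ (cong (i ∷_))) ((i ∷ c) ≟ₐ (i ∷ x)) (c ≟ₐ x) = refl

split-prefix : ∀ i x ctx w →
  (T.under (i ∷ x) (map (i ∷_) ctx) (map (i ∷_) w) ≡ map (i ∷_) (T.under x ctx w)) ×
  (T.beside (i ∷ x) (map (i ∷_) ctx) (map (i ∷_) w) ≡ map (i ∷_) (T.beside x ctx w))
split-prefix i x ctx []      = refl , refl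
split-prefix i x ctx (c ∷ w) =
  trans (if-cong same (cong ((i ∷ c) ∷_) d) d) (map-if (T.reaches x c (D ++ ctx)) (c ∷ D) D) ,
  trans (if-cong same r (cong ((i ∷ c) ∷_) r)) (map-if (T.reaches x c (D ++ ctx)) (T.beside x ctx w) (c ∷ T.beside x ctx w))
  where
  D = T.under x ctx w
  d = proj₁ (split-prefix i x ctx w)
  r = proj₂ (split-prefix i x ctx w)
  same = trans (cong (λ D' → T.reaches (i ∷ x) (i ∷ c) (D' ++ map (i ∷_) ctx)) d)
           (trans (cong (T.reaches (i ∷ x) (i ∷ c)) (sym (map-++ (i ∷_) D ctx))) (reaches-prefix i x c (D ++ ctx)))
  map-if : ∀ b (p q : List Addr) → (if b then map (i ∷_) p else map (i ∷_) q) ≡ map (i ∷_) (if b then p else q)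
  map-if true  p q = refl
  map-if false p q = refl

pyramid-prefix⁺ : ∀ i P → T.Pyramid [] P → T.Pyramid (i ∷ []) (map (i ∷_) P)
pyramid-prefix⁺ i P pyr = trans (proj₂ (split-prefix i [] [] P)) (cong (map (i ∷_)) pyr)

pyramid-prefix⁻ : ∀ i P → T.Pyramid (i ∷ []) (map (i ∷_) P) → T.Pyramid [] P
pyramid-prefix⁻ i P pyr with T.beside [] [] P | proj₂ (split-prefix i [] [] P)
... | [] | _ = refl
... | _ ∷ _ | e = case trans (sym e) pyr of λ ()

dep-root-child : ∀ j → T.dep (j ∷ []) [] ≡ true
dep-root-child j = dec-true (T.dependent? (j ∷ []) []) (inj₂ (inj₂ (j , refl)))

indep-root-grandchild : ∀ j a → a ≢ [] → T.dep (j ∷ a) [] ≡ false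
indep-root-grandchild j a a≢[] = dec-false (T.dependent? (j ∷ a) []) λ
  { (inj₁ ()) ; (inj₂ (inj₁ (i , ()))) ; (inj₂ (inj₂ (i , e))) → a≢[] (∷-injectiveʳ e) }

valid-child : ∀ {n} {x : Fin n} {ts i c a} → nth ts i ≡ just c → ValidAddr c a → ValidAddr (node x ts) (i ∷ a)
valid-child {ts = ts} {i} ith v with nth ts i
valid-child refl v | just _ = v

valid-child⁻ : ∀ {n} {x : Fin n} {ts i c a} → nth ts i ≡ just c → ValidAddr (node x ts) (i ∷ a) → ValidAddr c a
valid-child⁻ {ts = ts} {i} ith v with nth ts i
valid-child⁻ ith  (s , ()) | nothing
valid-child⁻ refl v        | just _ = v

label-child : ∀ {n} {x : Fin n} {ts i c a} → nth ts i ≡ just c → ValidAddr c a → label (node x ts) (i ∷ a) ≡ label c a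
label-child {ts = ts} {i} ith (s , sv) with nth ts i
label-child refl (s , sv) | just _ rewrite sv = refl

valid-child-nth : ∀ {n} {x : Fin n} {ts i a} → ValidAddr (node x ts) (i ∷ a) → ∃ λ c → nth ts i ≡ just c
valid-child-nth {ts = ts} {i} v with nth ts i
valid-child-nth (s , ()) | nothing
valid-child-nth v        | just c = c , refl

nth-++ : ∀ {A : Set} (Pre : List A) c cs → nth (Pre ++ c ∷ cs) (length Pre) ≡ just c
nth-++ []        c cs = refl
nth-++ (x ∷ Pre) c cs = nth-++ Pre c cs

nth⇒< : ∀ {A : Set} (ts : List A) j {c} → nth ts j ≡ just c → j < length ts
nth⇒< (x ∷ ts) zero    e = s≤s z≤n
nth⇒< (x ∷ ts) (suc j) e = s≤s (nth⇒< ts j e)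

ValidWord⇒All : ∀ {n} {t : Tree n} {w} → ValidWord t w → All (ValidAddr t) w
ValidWord⇒All []       = []
ValidWord⇒All (v ∷ vs) = v ∷ ValidWord⇒All vs

All⇒ValidWord : ∀ {n} {t : Tree n} {w} → All (ValidAddr t) w → ValidWord t w
All⇒ValidWord []       = []
All⇒ValidWord (v ∷ vs) = v ∷ All⇒ValidWord vs

Suffix : ∀ {A : Set} → List A → ℕ → List A → Set
Suffix ts i cs = ∃ λ Pre → ts ≡ Pre ++ cs × length Pre ≡ i

suffix-head : ∀ {A : Set} {ts i c cs} → Suffix {A} ts i (c ∷ cs) → nth ts i ≡ just c
suffix-head (Pre , refl , refl) = nth-++ Pre _ _

suffix-tail : ∀ {A : Set} {ts i c cs} → Suffix {A} ts i (c ∷ cs) → Suffix ts (suc i) cs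
suffix-tail {c = c} (Pre , refl , refl) =
  Pre ∷ʳ c , sym (++-assoc Pre (c ∷ []) _) , trans (length-++ Pre) (+-comm (length Pre) 1)

suffix-end : ∀ {A : Set} {ts i} → Suffix {A} ts i [] → length ts ≡ i
suffix-end (Pre , refl , refl) = cong length (++-identityʳ Pre)

labels-prefix : ∀ {n} {x : Fin n} {ts i c} → nth ts i ≡ just c → ∀ {P} → All (ValidAddr c) P →
                map (label (node x ts)) (map (i ∷_) P) ≡ map (label c) P
labels-prefix ith []       = refl
labels-prefix {x = x} {ts} {i} {c} ith (v ∷ vs) = cong₂ _∷_ (label-child {x = x} {ts} {i} {c} ith v) (labels-prefix ith vs)

valid-prefix : ∀ {n} {x : Fin n} {ts i c} → nth ts i ≡ just c → ∀ {P} → All (ValidAddr c) P →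
               All (ValidAddr (node x ts)) (map (i ∷_) P)
valid-prefix ith []       = []
valid-prefix {x = x} {ts} {i} {c} ith (v ∷ vs) = valid-child {x = x} {ts} {i} {c} ith v ∷ valid-prefix ith vs

InSubtree : ℕ → Addr → Set
InSubtree i a = ∃ λ b → a ≡ i ∷ b

prefix-restrict : ∀ i L → All (InSubtree i) L → L ≡ map (i ∷_) (restrict i L)
prefix-restrict i []              []                = refl
prefix-restrict i (.(i ∷ b) ∷ L) ((b , refl) ∷ hs) rewrite dec-true (i Data.Nat.≟ i) refl = cong ((i ∷ b) ∷_) (prefix-restrict i L hs)

restrict-valid : ∀ {n} {x : Fin n} {ts i c} → nth ts i ≡ just c → ∀ L → All (ValidAddr (node x ts)) L → All (InSubtree i) L →
                 All (ValidAddr c) (restrict i L)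
restrict-valid ith []              []       []                = []
restrict-valid {x = x} {ts} {i} {c} ith (.(i ∷ b) ∷ L) (v ∷ vs) ((b , refl) ∷ hs) rewrite dec-true (i Data.Nat.≟ i) refl =
  valid-child⁻ {x = x} {ts} {i} {c} ith v ∷ restrict-valid ith L vs hs

under-child-inSubtree : ∀ i R → All (_≢ []) R → All (InSubtree i) (T.under (i ∷ []) [] R)
under-child-inSubtree i R nonroot = All.map (chain-inSubtree i) (T.under-chain (i ∷ []) [] nonroot [])

OutsideFirstChildren : ℕ → Addr → Set
OutsideFirstChildren k a = ∀ j → j < k → a ≢ j ∷ []

outsideFirstChildren-suc : ∀ i a → OutsideFirstChildren i a → a ≢ i ∷ [] → OutsideFirstChildren (suc i) a
outsideFirstChildren-suc i a out a≢i j (s≤s j≤i) with m≤n⇒m<n∨m≡n j≤i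
... | inj₁ j<i  = out j j<i
... | inj₂ refl = a≢i

-- Letters of a pyramid at the root other than the root and its children would be initial.
outside-children-empty : ∀ {n} (x : Fin n) ts t Y Rest → T.Pyramid [] (t ∷ʳ []) → t T.≈ (Y ++ Rest) →
  All (OutsideFirstChildren (length ts)) Rest → All (ValidAddr (node x ts)) Rest → All (_≢ []) Rest → Rest ≡ []
outside-children-empty x ts t Y Rest pyr t≈ out valid nonroot with initLast Rest
... | []                  = refl
... | z ∷ʳ′ []            = ⊥-elim (All-last nonroot refl)
... | z ∷ʳ′ (j ∷ [])      = ⊥-elim (All-last out j (nth⇒< ts j (proj₂ (valid-child-nth {x = x} {ts} (All-last valid)))) refl)
... | z ∷ʳ′ (j ∷ k ∷ a)   = case T.Pyramid⇒InP [] (t ∷ʳ []) pyr (j ∷ k ∷ a) ((Y ++ z) ∷ʳ [] , initial) of λ ()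
  where
  indep = T.independent (indep-root-grandchild j (k ∷ a) (λ ()))
  initial = T.≈-trans (T.≈-congʳ ([] ∷ []) t≈) (T.swap-last Y z (j ∷ k ∷ a) [] (proj₁ indep) (proj₂ indep))

module Graph {n : ℕ} (adj : Fin n → Fin n → Bool) (symm : Symmetric adj) where

  open StablePath adj public

  adjacent? : ∀ a b → Dec (Adjacent adj a b)
  adjacent? a b = adj a b Data.Bool.≟ true

  Adjacent-sym : ∀ {a b} → Adjacent adj a b → Adjacent adj b a
  Adjacent-sym {a} {b} p = trans (symm b a) p

  module G = PartiallyCommutative Data.Fin._≟_ (Adjacent adj) adjacent? Adjacent-sym

  infix 4 _⊆_
  _⊆_ : Subset → Subset → Set
  S ⊆ S' = ∀ v → S v ≡ true → S' v ≡ true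

  count : Subset → List (Fin n) → ℕ
  count S []      = 0
  count S (v ∷ L) = if S v then suc (count S L) else count S L

  size : Subset → ℕ
  size S = count S (allFin n)

  count-mono : ∀ {R R'} → R ⊆ R' → ∀ L → count R L ≤ count R' L
  count-mono h [] = z≤n
  count-mono {R} {R'} h (v ∷ L) with R v in e | R' v in e'
  ... | true  | true  = s≤s (count-mono h L)
  ... | true  | false = case trans (sym (h v e)) e' of λ ()
  ... | false | true  = m≤n⇒m≤1+n (count-mono h L)
  ... | false | false = count-mono h L

  count-strict-mono : ∀ {R R'} → R ⊆ R' → ∀ {x} L → x ∈ L → R x ≡ false → R' x ≡ true → suc (count R L) ≤ count R' L
  count-strict-mono {R} {R'} h (v ∷ L) (here refl) rf rt rewrite rf | rt = s≤s (count-mono h L)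
  count-strict-mono {R} {R'} h (v ∷ L) (there p) rf rt with R v in e | R' v in e'
  ... | true  | true  = s≤s (count-strict-mono h L p rf rt)
  ... | true  | false = case trans (sym (h v e)) e' of λ ()
  ... | false | true  = m≤n⇒m≤1+n (count-strict-mono h L p rf rt)
  ... | false | false = count-strict-mono h L p rf rt

  count≤length : ∀ S L → count S L ≤ length L
  count≤length S []      = z≤n
  count≤length S (v ∷ L) with S v
  ... | true  = s≤s (count≤length S L)
  ... | false = m≤n⇒m≤1+n (count≤length S L)

  size≤n : ∀ S → size S ≤ n
  size≤n S = ≤-trans (count≤length S (allFin n)) (≤-reflexive (length-tabulate (λ x → x)))

  size-pos : ∀ S {x} → S x ≡ true → 1 ≤ size S
  size-pos S {x} sx = ≤-trans (s≤s z≤n) (count-strict-mono {R = λ _ → false} (λ _ ()) (allFin n) (∈-allFin x) refl sx)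

  remove-⊆ : ∀ v S → remove v S ⊆ S
  remove-⊆ v S w p with S w
  ... | true  = refl
  ... | false = p

  remove-≢ : ∀ v S w → remove v S w ≡ true → v ≢ w
  remove-≢ v S w p refl with S v
  ... | false = case p of λ ()
  ... | true rewrite dec-true (v Data.Fin.≟ v) refl = case p of λ ()

  remove⁺ : ∀ v S w → S w ≡ true → v ≢ w → remove v S w ≡ true
  remove⁺ v S w p v≢w rewrite p | dec-false (v Data.Fin.≟ w) v≢w = refl

  size-remove : ∀ v S → S v ≡ true → suc (size (remove v S)) ≤ size S
  size-remove v S p = count-strict-mono (remove-⊆ v S) (allFin n) (∈-allFin v) removed p
    where
    removed : remove v S v ≡ false
    removed rewrite dec-true (v Data.Fin.≟ v) refl with S v
    ... | true  = refl
    ... | false = refl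

  size≤1-unique : ∀ S u v → size S ≤ 1 → S u ≡ true → S v ≡ true → v ≡ u
  size≤1-unique S u v h su sv with v Data.Fin.≟ u
  ... | yes v≡u = v≡u
  ... | no  v≢u = case ≤-trans (s≤s (size-pos (remove u S) (remove⁺ u S v sv (λ e → v≢u (sym e)))))
                               (≤-trans (size-remove u S su) h) of λ { (s≤s ()) }

  any-witness : ∀ (p : Fin n → Bool) {x} L → x ∈ L → p x ≡ true → any p L ≡ true
  any-witness p (y ∷ L) (here refl) px rewrite px = refl
  any-witness p (y ∷ L) (there m)   px = ∨-introʳ (p y) (any-witness p L m px)

  any-cong : ∀ {p q : Fin n → Bool} → (∀ x → p x ≡ q x) → ∀ L → any p L ≡ any q L
  any-cong h []      = refl
  any-cong h (y ∷ L) = cong₂ _∨_ (h y) (any-cong h L)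

  Closed : Subset → Subset → Set
  Closed S R = ∀ x → closeStep S R x ≡ true → R x ≡ true

  closeStep-cong : ∀ S {R R'} → R ≗ R' → closeStep S R ≗ closeStep S R'
  closeStep-cong S h x = cong₂ _∨_ (h x) (cong (S x ∧_) (any-cong (λ w → cong (_∧ adj w x) (h w)) (allFin n)))

  closeStep-⊇ : ∀ S R → R ⊆ closeStep S R
  closeStep-⊇ S R x p rewrite p = refl

  closed⇒fixed : ∀ {S R} → Closed S R → closeStep S R ≗ R
  closed⇒fixed {S} {R} c x with R x in r
  ... | true = refl
  ... | false with S x ∧ any (λ w → R w ∧ adj w x) (allFin n) in e
  ...   | false = refl
  ...   | true  = case trans (sym (c x (∨-introʳ (R x) e))) r of λ ()

  iterate-closed : ∀ {S R} → Closed S R → ∀ k {R'} → R' ≗ R → iterate k S R' ≗ R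
  iterate-closed c zero    h = h
  iterate-closed {S} c (suc k) h = iterate-closed c k (λ x → trans (closeStep-cong S h x) (closed⇒fixed c x))

  closed-resp-≗ : ∀ {S R R'} → R ≗ R' → Closed S R → Closed S R'
  closed-resp-≗ {S} h c x p = trans (sym (h x)) (c x (trans (closeStep-cong S h x) p))

  closed? : ∀ S R → Dec (Closed S R)
  closed? S R = all? (λ x → (closeStep S R x Data.Bool.≟ true) →-dec (R x Data.Bool.≟ true))

  not-closed : ∀ S R → ¬ Closed S R → ∃ λ x → closeStep S R x ≡ true × R x ≡ false
  not-closed S R nc with ¬∀⟶∃¬ n _ (λ x → (closeStep S R x Data.Bool.≟ true) →-dec (R x Data.Bool.≟ true)) nc
  ... | x , np = x , counterexample _ _ np
    where
    counterexample : ∀ a b → ¬ (a ≡ true → b ≡ true) → a ≡ true × b ≡ false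
    counterexample _     true  np = ⊥-elim (np (λ _ → refl))
    counterexample false false np = ⊥-elim (np (λ ()))
    counterexample true  false np = refl , refl

  iterate-grows : ∀ S k R → Closed S (iterate k S R) ⊎ (k + size R ≤ size (iterate k S R))
  iterate-grows S zero    R = inj₂ ≤-refl
  iterate-grows S (suc k) R with closed? S R
  ... | yes c = inj₁ (closed-resp-≗ (λ x → sym (iterate-closed c k (closed⇒fixed c) x)) c)
  ... | no nc with not-closed S R nc
  ...   | x , cx , rx with iterate-grows S k (closeStep S R)
  ...     | inj₁ c = inj₁ c
  ...     | inj₂ h = inj₂ (≤-trans (≤-reflexive (sym (+-suc k (size R))))
                             (≤-trans (+-monoʳ-≤ k (count-strict-mono (closeStep-⊇ S R) (allFin n) (∈-allFin x) rx cx)) h))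

  singleton-self : ∀ v → singleton v v ≡ true
  singleton-self v = dec-true (v Data.Fin.≟ v) refl

  component-closed : ∀ S v → Closed S (component S v)
  component-closed S v with iterate-grows S n (singleton v)
  ... | inj₁ c = c
  ... | inj₂ h = ⊥-elim (m+1+n≰m n (≤-trans (+-monoʳ-≤ n (size-pos (singleton v) (singleton-self v))) (≤-trans h (size≤n _))))

  iterate-⊇ : ∀ S k R → R ⊆ iterate k S R
  iterate-⊇ S zero    R x p = p
  iterate-⊇ S (suc k) R x p = iterate-⊇ S k (closeStep S R) x (closeStep-⊇ S R x p)

  iterate-⊆ : ∀ S k R → R ⊆ S → iterate k S R ⊆ S
  iterate-⊆ S zero    R h = h
  iterate-⊆ S (suc k) R h = iterate-⊆ S k (closeStep S R) step-⊆
    where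
    step-⊆ : closeStep S R ⊆ S
    step-⊆ x p with ∨-elim (R x) p
    ... | inj₁ q = h x q
    ... | inj₂ q with S x
    ...   | true  = refl
    ...   | false = q

  component-self : ∀ S v → component S v v ≡ true
  component-self S v = iterate-⊇ S n (singleton v) v (singleton-self v)

  component-⊆ : ∀ S v → S v ≡ true → component S v ⊆ S
  component-⊆ S v sv = iterate-⊆ S n (singleton v) λ x p → subst (λ y → S y ≡ true) (does⇒ (v Data.Fin.≟ x) p) sv

  component-chain : ∀ S v {e} → G.Chain (λ e → S e ≡ true) v e → component S v e ≡ true
  component-chain S v G.base = component-self S v
  component-chain S v (G.step {e} {e'} se d ch) with does⇒ (G.dependent? e e') d
  ... | inj₁ refl = component-chain S v ch
  ... | inj₂ a    = component-closed S v e (∨-introʳ (component S v e) reached)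
    where
    reached : S e ∧ any (λ w → component S v w ∧ adj w e) (allFin n) ≡ true
    reached rewrite se = any-witness (λ w → component S v w ∧ adj w e) (allFin n) (∈-allFin e') link
      where
      link : component S v e' ∧ adj e' e ≡ true
      link rewrite component-chain S v ch = Adjacent-sym a

  nbrs⁻ : ∀ S u {v} → v ∈ nbrs S u → S v ≡ true × adj u v ≡ true
  nbrs⁻ S u {v} m = T-∧ (proj₂ (∈-filter⁻ (λ v → T? (S v ∧ adj u v)) {xs = allFin n} m))
    where
    T-∧ : ∀ {a b} → T (a ∧ b) → a ≡ true × b ≡ true
    T-∧ {true} {true} _ = refl , refl

  nbrs⁺ : ∀ S u {v} → S v ≡ true → adj u v ≡ true → v ∈ nbrs S u
  nbrs⁺ S u {v} sv a = ∈-filter⁺ (λ v → T? (S v ∧ adj u v)) (∈-allFin v) (subst₂ (λ p q → T (p ∧ q)) (sym sv) (sym a) _)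

  nbrs-unique : ∀ S u → Unique (nbrs S u)
  nbrs-unique S u = Unique.filter⁺ (λ v → T? (S v ∧ adj u v)) (Unique.allFin⁺ n)

  nbrs-all : ∀ S u → All (λ v → S v ≡ true × adj u v ≡ true) (nbrs S u)
  nbrs-all S u = All.tabulate (nbrs⁻ S u)

module Construction {n : ℕ} (adj : Fin n → Fin n → Bool) (symm : Symmetric adj) (irr : Irreflexive adj) where

  open Graph adj symm

  -- f and m are fuel, sufficient once size S ≤ suc f and length w ≤ m.
  mutual
    toTree : ℕ → Subset → Fin n → ℕ → List (Fin n) → List Addr
    toTree zero    S u m       w           = map (λ _ → []) w
    toTree (suc f) S u zero    w           = []
    toTree (suc f) S u (suc m) []          = []
    toTree (suc f) S u (suc m) w@(_ ∷ _)   =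
      (toTree (suc f) S u m (G.under u [] q) ++ toForest f (suc m) (remove u S) (nbrs S u) 0 (G.beside u [] q)) ∷ʳ []
      where q = dropLast w

    toForest : ℕ → ℕ → Subset → List (Fin n) → ℕ → List (Fin n) → List Addr
    toForest f m S' []       i r = []
    toForest f m S' (v ∷ vs) i r =
      map (i ∷_) (toTree f (component S' v) v m (G.under v [] r)) ++ toForest f m (remove v S') vs (suc i) (G.beside v [] r)

  toTree-∷ʳ : ∀ f S u m q v → toTree (suc f) S u (suc m) (q ∷ʳ v) ≡
    (toTree (suc f) S u m (G.under u [] q) ++ toForest f (suc m) (remove u S) (nbrs S u) 0 (G.beside u [] q)) ∷ʳ []
  toTree-∷ʳ f S u m []      v = refl
  toTree-∷ʳ f S u m (c ∷ q) v rewrite dropLast-∷ʳ (c ∷ q) v = refl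

  blocks : List (Fin n) → List (Fin n) → List (Fin n)
  blocks []       r = []
  blocks (v ∷ vs) r = G.under v [] r ++ blocks vs (G.beside v [] r)

  leftover : List (Fin n) → List (Fin n) → List (Fin n)
  leftover []       r = r
  leftover (v ∷ vs) r = leftover vs (G.beside v [] r)

  ≈-blocks++leftover : ∀ vs r → r G.≈ (blocks vs r ++ leftover vs r)
  ≈-blocks++leftover []       r = G.≈-refl
  ≈-blocks++leftover (v ∷ vs) r = G.≈-trans (G.≈-under++beside v [] r)
    (G.≈-trans (G.≈-congˡ (G.under v [] r) (≈-blocks++leftover vs (G.beside v [] r)))
      (G.≡⇒≈ (sym (++-assoc (G.under v [] r) _ _))))

  All-leftover : ∀ {P : Fin n → Set} vs r → All P r → All P (leftover vs r)
  All-leftover []       r p = p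
  All-leftover (v ∷ vs) r p = All-leftover vs _ (G.All-beside v [] p)

  leftover-avoids : ∀ vs r → All (λ e → All (e ≢_) vs) (leftover vs r)
  leftover-avoids []       r = All.universal (λ _ → []) r
  leftover-avoids (v ∷ vs) r =
    All.zipWith (λ { (e≢v , e∉vs) → e≢v ∷ e∉vs }) (All-leftover vs _ (G.beside-avoids v [] r) , leftover-avoids vs (G.beside v [] r))

  InS : Subset → List (Fin n) → Set
  InS S = All (λ v → S v ≡ true)

  -- A last letter of the leftover would be independent of u, so it could be moved past the apex.
  leftover-empty : ∀ S u q → InS S q → G.Pyramid u (q ∷ʳ u) → leftover (nbrs S u) (G.beside u [] q) ≡ []
  leftover-empty S u q iq pyr with leftover (nbrs S u) (G.beside u [] q) in eq
  ... | L with initLast L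
  ...   | []      = refl
  ...   | z ∷ʳ′ e = ⊥-elim (e≢u (G.Pyramid⇒InP u (q ∷ʳ u) pyr e ((Y ++ z) ∷ʳ u , swapped)))
    where
    vs = nbrs S u
    r  = G.beside u [] q
    e∈S×e≢u = All-last (subst (All _) eq (All-leftover vs r (All.zip (G.All-beside u [] iq , G.beside-avoids u [] q))))
    e≢u = proj₂ e∈S×e≢u
    e∉vs = All-last (subst (All _) eq (leftover-avoids vs r))
    ¬adj : ¬ Adjacent adj e u
    ¬adj a = All.lookup e∉vs (nbrs⁺ S u (proj₁ e∈S×e≢u) (Adjacent-sym a)) refl
    Y = G.under u [] q ++ blocks vs r
    q≈ : q G.≈ (Y ++ (z ∷ʳ e))
    q≈ = G.≈-trans (G.≈-under++beside u [] q)
           (G.≈-trans (G.≈-congˡ (G.under u [] q) (G.≈-trans (≈-blocks++leftover vs r) (G.≡⇒≈ (cong (blocks vs r ++_) eq))))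
             (G.≡⇒≈ (sym (++-assoc (G.under u [] q) (blocks vs r) _))))
    swapped : (q ∷ʳ u) G.≈ (((Y ++ z) ∷ʳ u) ∷ʳ e)
    swapped = G.≈-trans (G.≈-congʳ (u ∷ []) q≈) (G.swap-last Y z e u e≢u ¬adj)

  decompose : ∀ S u q → InS S q → G.Pyramid u (q ∷ʳ u) → q G.≈ (G.under u [] q ++ blocks (nbrs S u) (G.beside u [] q))
  decompose S u q iq pyr = G.≈-trans (G.≈-under++beside u [] q) (G.≈-congˡ (G.under u [] q)
    (G.≈-trans (≈-blocks++leftover (nbrs S u) r)
      (G.≡⇒≈ (trans (cong (blocks (nbrs S u) r ++_) (leftover-empty S u q iq pyr)) (++-identityʳ _)))))
    where r = G.beside u [] q

  Fits : ℕ → Subset → Fin n → Set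
  Fits f S u = S u ≡ true × size S ≤ suc f

  block-InS : ∀ S' v r → InS S' r → InS (component S' v) (G.under v [] r)
  block-InS S' v r h = All.map (component-chain S' v) (G.under-chain v [] h [])

  block-Fits : ∀ f S' v → S' v ≡ true → size S' ≤ suc f → Fits f (component S' v) v
  block-Fits f S' v sv sz = component-self S' v , ≤-trans (count-mono (component-⊆ S' v sv) (allFin n)) sz

  beside-InS : ∀ S' v r → InS S' r → InS (remove v S') (G.beside v [] r)
  beside-InS S' v r h = All.zipWith (λ { (a , b) → remove⁺ v S' _ a (λ e → b (sym e)) }) (G.All-beside v [] h , G.beside-avoids v [] r)

  remove-InS : ∀ S' v {xs} → InS S' xs → All (v ≢_) xs → InS (remove v S') xs
  remove-InS S' v h ne = All.zipWith (λ { (a , b) → remove⁺ v S' _ a b }) (h , ne)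

  remove-size : ∀ S' v f → size S' ≤ suc f → size (remove v S') ≤ suc f
  remove-size S' v f sz = ≤-trans (count-mono (remove-⊆ v S') (allFin n)) sz

  nbrs-InS : ∀ S u → InS (remove u S) (nbrs S u)
  nbrs-InS S u = All.map (λ { (sv , a) → remove⁺ u S _ sv (λ { refl → case trans (sym a) (irr u) of λ () }) }) (nbrs-all S u)

  root-removed-size : ∀ f S u → Fits (suc f) S u → size (remove u S) ≤ suc f
  root-removed-size f S u (su , sz) with ≤-trans (size-remove u S su) sz
  ... | s≤s p = p

  record Image (t : Tree n) (w : List (Fin n)) (p : List Addr) : Set where
    field
      valid   : All (ValidAddr t) p
      pyramid : T.Pyramid [] p
      length≡ : length p ≡ length w
      labels  : map (label t) p ↭ w

  AbsorbedByRoot : List Addr → Set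
  AbsorbedByRoot K = ∀ ctx → (∀ j → T.dependsOnAny (j ∷ []) ctx ≡ true) → T.under [] ctx K ≡ K × T.beside [] ctx K ≡ []

  record ForestImage (t : Tree n) (w : List (Fin n)) (K : List Addr) : Set where
    field
      valid    : All (ValidAddr t) K
      absorbed : AbsorbedByRoot K
      length≡  : length K ≡ length w
      labels   : map (label t) K ↭ w

  ImageInvariant : ℕ → Set
  ImageInvariant f = ∀ S v → Fits f S v → ∀ m w → InS S w → G.Pyramid v w → length w ≤ m →
                     Image (build f S v) w (toTree f S v m w)

  toForest-image : ∀ f → ImageInvariant f → ∀ x ts m S' vs i r → Suffix ts i (children f S' vs) → size S' ≤ suc f →
    InS S' vs → Unique vs → InS S' r → length r ≤ m → ForestImage (node x ts) (blocks vs r) (toForest f m S' vs i r)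
  toForest-image f IH x ts m S' []       i r pos sz []         []          ir lr =
    record { valid = [] ; absorbed = λ _ _ → refl , refl ; length≡ = refl ; labels = ↭-refl }
  toForest-image f IH x ts m S' (v ∷ vs) i r pos sz (sv ∷ svs) (v∉ ∷ uvs) ir lr = record
    { valid    = ++⁺ (valid-prefix ith (Image.valid A)) (ForestImage.valid R)
    ; absorbed = λ ctx h → T.absorbed-++ [] (i ∷ []) ctx (map (i ∷_) P) K (pyramid-prefix⁺ i P (Image.pyramid A))
                   (∨-introʳ (does ((i ∷ []) ≟ₐ [])) (T.dependsOnAny-++ʳ (i ∷ []) K (h i)))
                   (proj₁ (ForestImage.absorbed R ctx h)) (proj₂ (ForestImage.absorbed R ctx h))
    ; length≡  = begin
        length (map (i ∷_) P ++ K)          ≡⟨ length-++ (map (i ∷_) P) ⟩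
        length (map (i ∷_) P) + length K    ≡⟨ cong₂ _+_ (trans (length-map (i ∷_) P) (Image.length≡ A)) (ForestImage.length≡ R) ⟩
        length s + length (blocks vs r')    ≡⟨ sym (length-++ s) ⟩
        length (s ++ blocks vs r')          ∎
    ; labels   = ↭-trans (↭-reflexive (map-++ (label (node x ts)) (map (i ∷_) P) K))
                   (Perm.++⁺ (↭-trans (↭-reflexive (labels-prefix ith (Image.valid A))) (Image.labels A)) (ForestImage.labels R))
    }
    where
    open ≡-Reasoning
    ith = suffix-head pos
    s   = G.under v [] r
    r'  = G.beside v [] r
    P   = toTree f (component S' v) v m s
    K   = toForest f m (remove v S') vs (suc i) r'
    A   = IH (component S' v) v (block-Fits f S' v sv sz) m s (block-InS S' v r ir) (G.under-pyramid v [] r)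
             (≤-trans (G.under-length≤ v [] r) lr)
    R   = toForest-image f IH x ts m (remove v S') vs (suc i) r' (suffix-tail pos) (remove-size S' v f sz)
             (remove-InS S' v svs v∉) uvs (beside-InS S' v r ir) (≤-trans (G.beside-length≤ v [] r) lr)

  empty-image : ∀ t → Image t [] []
  empty-image t = record { valid = [] ; pyramid = refl ; length≡ = refl ; labels = ↭-refl }

  root-reached : ∀ j → T.dependsOnAny (j ∷ []) ([] ∷ []) ≡ true
  root-reached j rewrite dep-root-child j = refl

  toTree-image-∷ʳ : ∀ f → ImageInvariant f → ∀ S u → Fits (suc f) S u → ∀ m q → InS S (q ∷ʳ u) →
    G.Pyramid u (q ∷ʳ u) → length (q ∷ʳ u) ≤ suc m →
    Image (build (suc f) S u) (G.under u [] q) (toTree (suc f) S u m (G.under u [] q)) →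
    Image (build (suc f) S u) (q ∷ʳ u) (toTree (suc f) S u (suc m) (q ∷ʳ u))
  toTree-image-∷ʳ f IH S u fits m q iw pyr lw IHm rewrite toTree-∷ʳ f S u m q u = record
    { valid   = ∷ʳ⁺ (++⁺ (Image.valid IHm) (ForestImage.valid KA)) (node u ts , refl)
    ; pyramid = T.absorbed⇒pyramid-∷ʳ [] (P ++ K)
                  (proj₂ (T.absorbed-++ [] [] ([] ∷ []) P K (Image.pyramid IHm) (T.reaches-self [] (K ++ [] ∷ []))
                  (proj₁ (ForestImage.absorbed KA ([] ∷ []) root-reached)) (proj₂ (ForestImage.absorbed KA ([] ∷ []) root-reached))))
    ; length≡ = begin
        length ((P ++ K) ∷ʳ [])                    ≡⟨ length-++ (P ++ K) ⟩
        length (P ++ K) + 1                        ≡⟨ cong (_+ 1) (length-++ P) ⟩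
        length P + length K + 1                    ≡⟨ cong (_+ 1) (cong₂ _+_ (Image.length≡ IHm) (ForestImage.length≡ KA)) ⟩
        length q₀ + length (blocks vs r) + 1       ≡⟨ cong (_+ 1) (sym (length-++ q₀)) ⟩
        length (q₀ ++ blocks vs r) + 1             ≡⟨ cong (_+ 1) (sym (G.≈-length q≈)) ⟩
        length q + 1                               ≡⟨ sym (length-++ q) ⟩
        length (q ∷ʳ u)                            ∎
    ; labels  = ↭-trans (↭-reflexive (trans (map-++ (label t) (P ++ K) ([] ∷ [])) (cong (_++ (u ∷ [])) (map-++ (label t) P K))))
                  (Perm.++⁺ʳ (u ∷ []) (↭-trans (Perm.++⁺ (Image.labels IHm) (ForestImage.labels KA)) (G.≈⇒↭ (G.≈-sym q≈))))
    }
    where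
    open ≡-Reasoning
    q₀ = G.under u [] q
    r  = G.beside u [] q
    vs = nbrs S u
    ts = children f (remove u S) vs
    t  = node u ts
    iq = ++⁻ˡ q iw
    P  = toTree (suc f) S u m q₀
    K  = toForest f (suc m) (remove u S) vs 0 r
    KA = toForest-image f IH u ts (suc m) (remove u S) vs 0 r ([] , refl , refl) (root-removed-size f S u fits)
           (nbrs-InS S u) (nbrs-unique S u) (beside-InS S u q iq)
           (≤-trans (G.beside-length≤ u [] q) (m≤n⇒m≤1+n (length-∷ʳ≤ q u lw)))
    q≈ = decompose S u q iq pyr

  toTree-image-suc : ∀ f → ImageInvariant f → ImageInvariant (suc f)
  toTree-image-suc f IH S u fits zero    []      iw pyr lw = empty-image _
  toTree-image-suc f IH S u fits zero    (_ ∷ _) iw pyr ()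
  toTree-image-suc f IH S u fits (suc m) w       iw pyr lw with initLast w
  ... | []      = empty-image _
  ... | q ∷ʳ′ v with G.pyramid-last u q v pyr
  ...   | refl = toTree-image-∷ʳ f IH S u fits m q iw pyr lw
                   (toTree-image-suc f IH S u fits m (G.under u [] q) (G.All-under u [] (++⁻ˡ q iw)) (G.under-pyramid u [] q)
                      (≤-trans (G.under-length≤ u [] q) (length-∷ʳ≤ q u lw)))

  toTree-image : ∀ f → ImageInvariant f
  toTree-image zero S u (su , sz) m w iw pyr lw = record
    { valid   = All.map⁺ (All.universal (λ _ → node u [] , refl) w)
    ; pyramid = T.all-x⇒beside≡[] [] [] _ (All.map⁺ (All.universal (λ _ → refl) w))
    ; length≡ = length-map _ w
    ; labels  = ↭-reflexive (trans (sym (map-∘ w)) (map-const w (All.map (λ se → size≤1-unique S u _ sz su se) iw)))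
    }
  toTree-image (suc f) = toTree-image-suc f (toTree-image f)

  CompatInvariant : ℕ → Set
  CompatInvariant f = ∀ S v m w w' → G.Pyramid v w → G.Pyramid v w' → length w ≤ m → w G.≈ w' →
                      toTree f S v m w T.≈ toTree f S v m w'

  toForest-resp-≈ : ∀ f → CompatInvariant f → ∀ m S' vs i r r' → length r ≤ m → r G.≈ r' →
                    toForest f m S' vs i r T.≈ toForest f m S' vs i r'
  toForest-resp-≈ f IH m S' []       i r r' lr e = T.≈-refl
  toForest-resp-≈ f IH m S' (v ∷ vs) i r r' lr e = T.≈-++
    (prefix-≈ i (IH (component S' v) v m _ _ (G.under-pyramid v [] r) (G.under-pyramid v [] r')
                    (≤-trans (G.under-length≤ v [] r) lr) (proj₁ split)))
    (toForest-resp-≈ f IH m (remove v S') vs (suc i) _ _ (≤-trans (G.beside-length≤ v [] r) lr) (proj₂ split))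
    where split = G.split-resp-≈ v [] e

  toTree-resp-≈-suc : ∀ f → CompatInvariant f → CompatInvariant (suc f)
  toTree-resp-≈-suc f IH S u zero    w w' pyr pyr' lw e = T.≈-refl
  toTree-resp-≈-suc f IH S u (suc m) w w' pyr pyr' lw e with initLast w | initLast w'
  ... | []      | []        = T.≈-refl
  ... | []      | q' ∷ʳ′ v' = ⊥-elim (∷ʳ≢[] q' v' (G.≈[]⇒≡[] (G.≈-sym e)))
  ... | q ∷ʳ′ v | []        = ⊥-elim (∷ʳ≢[] q v (G.≈[]⇒≡[] e))
  ... | q ∷ʳ′ v | q' ∷ʳ′ v' with G.pyramid-last u q v pyr | G.pyramid-last u q' v' pyr'
  ...   | refl | refl rewrite toTree-∷ʳ f S u m q u | toTree-∷ʳ f S u m q' u =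
    T.≈-congʳ ([] ∷ []) (T.≈-++
      (toTree-resp-≈-suc f IH S u m _ _ (G.under-pyramid u [] q) (G.under-pyramid u [] q')
         (≤-trans (G.under-length≤ u [] q) (length-∷ʳ≤ q u lw)) (proj₁ split))
      (toForest-resp-≈ f IH (suc m) (remove u S) (nbrs S u) 0 _ _
         (≤-trans (G.beside-length≤ u [] q) (m≤n⇒m≤1+n (length-∷ʳ≤ q u lw))) (proj₂ split)))
    where split = G.split-resp-≈ u [] (G.∷ʳ-cancelʳ u e)

  toTree-resp-≈ : ∀ f → CompatInvariant f
  toTree-resp-≈ zero    S u m w w' pyr pyr' lw e = T.≡⇒≈ (map-const-length w w' (G.≈-length e))
  toTree-resp-≈ (suc f) = toTree-resp-≈-suc f (toTree-resp-≈ f)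

  toForest-nonroot : ∀ f m S' vs i r → All (_≢ []) (toForest f m S' vs i r)
  toForest-nonroot f m S' []       i r = []
  toForest-nonroot f m S' (v ∷ vs) i r =
    ++⁺ (All.map⁺ (All.universal (λ _ ()) _)) (toForest-nonroot f m (remove v S') vs (suc i) _)

  restrict-toForest-before : ∀ f m S' vs i r k → k < i → restrict k (toForest f m S' vs i r) ≡ []
  restrict-toForest-before f m S' []       i r k k<i = refl
  restrict-toForest-before f m S' (v ∷ vs) i r k k<i =
    trans (restrict-++ k (map (i ∷_) P) _)
      (cong₂ _++_ (restrict-otherPrefix k i P (λ { refl → <-irrefl refl k<i }))
                  (restrict-toForest-before f m (remove v S') vs (suc i) _ k (m≤n⇒m≤1+n k<i)))
    where P = toTree f (component S' v) v m (G.under v [] r)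

  restrict-toForest-head : ∀ f m S' v vs i r →
    restrict i (toForest f m S' (v ∷ vs) i r) ≡ toTree f (component S' v) v m (G.under v [] r)
  restrict-toForest-head f m S' v vs i r =
    trans (restrict-++ i (map (i ∷_) P) _)
      (trans (cong₂ _++_ (restrict-prefix i P) (restrict-toForest-before f m (remove v S') vs (suc i) _ i (n<1+n i)))
        (++-identityʳ P))
    where P = toTree f (component S' v) v m (G.under v [] r)

  restrict-toForest-tail : ∀ f m S' v vs i r k → k ≢ i →
    restrict k (toForest f m S' (v ∷ vs) i r) ≡ restrict k (toForest f m (remove v S') vs (suc i) (G.beside v [] r))
  restrict-toForest-tail f m S' v vs i r k k≢i =
    trans (restrict-++ k (map (i ∷_) P) K) (cong (_++ restrict k K) (restrict-otherPrefix k i P k≢i))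
    where
    P = toTree f (component S' v) v m (G.under v [] r)
    K = toForest f m (remove v S') vs (suc i) (G.beside v [] r)

  ReflectInvariant : ℕ → Set
  ReflectInvariant f = ∀ S v → Fits f S v → ∀ m w w' → InS S w → InS S w' → G.Pyramid v w → G.Pyramid v w' →
    length w ≤ m → length w' ≤ m → toTree f S v m w T.≈ toTree f S v m w' → w G.≈ w'

  toForest-reflects : ∀ f → ReflectInvariant f → ∀ m S' vs i r r' → size S' ≤ suc f → InS S' vs → Unique vs →
    InS S' r → InS S' r' → length r ≤ m → length r' ≤ m →
    (∀ k → restrict k (toForest f m S' vs i r) T.≈ restrict k (toForest f m S' vs i r')) → blocks vs r G.≈ blocks vs r'
  toForest-reflects f IH m S' []       i r r' sz []         []          ir ir' lr lr' h = G.≈-refl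
  toForest-reflects f IH m S' (v ∷ vs) i r r' sz (sv ∷ svs) (v∉ ∷ uvs) ir ir' lr lr' h = G.≈-++
    (IH (component S' v) v (block-Fits f S' v sv sz) m _ _ (block-InS S' v r ir) (block-InS S' v r' ir')
        (G.under-pyramid v [] r) (G.under-pyramid v [] r') (≤-trans (G.under-length≤ v [] r) lr) (≤-trans (G.under-length≤ v [] r') lr')
        (subst₂ T._≈_ (restrict-toForest-head f m S' v vs i r) (restrict-toForest-head f m S' v vs i r') (h i)))
    (toForest-reflects f IH m (remove v S') vs (suc i) _ _ (remove-size S' v f sz) (remove-InS S' v svs v∉) uvs
        (beside-InS S' v r ir) (beside-InS S' v r' ir') (≤-trans (G.beside-length≤ v [] r) lr) (≤-trans (G.beside-length≤ v [] r') lr')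
        restricted)
    where
    restricted : ∀ k → restrict k (toForest f m (remove v S') vs (suc i) (G.beside v [] r))
                     T.≈ restrict k (toForest f m (remove v S') vs (suc i) (G.beside v [] r'))
    restricted k with k Data.Nat.≟ i
    ... | yes refl = T.≡⇒≈ (trans (restrict-toForest-before f m _ vs (suc k) _ k (n<1+n k))
                                  (sym (restrict-toForest-before f m _ vs (suc k) _ k (n<1+n k))))
    ... | no  k≢i  = subst₂ T._≈_ (restrict-toForest-tail f m S' v vs i r k k≢i) (restrict-toForest-tail f m S' v vs i r' k k≢i) (h k)

  toTree-reflects-suc : ∀ f → ReflectInvariant f → ReflectInvariant (suc f)
  toTree-reflects-suc f IH S u fits zero    []      []       iw iw' pyr pyr' lw lw' e = G.≈-refl
  toTree-reflects-suc f IH S u fits zero    (_ ∷ _) _        iw iw' pyr pyr' () lw' e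
  toTree-reflects-suc f IH S u fits zero    []      (_ ∷ _)  iw iw' pyr pyr' lw () e
  toTree-reflects-suc f IH S u fits (suc m) w       w'       iw iw' pyr pyr' lw lw' e with initLast w | initLast w'
  ... | []      | []        = G.≈-refl
  ... | []      | q' ∷ʳ′ v' = ⊥-elim (∷ʳ≢[] _ [] (T.≈[]⇒≡[] (T.≈-sym (subst (T._≈_ []) (toTree-∷ʳ f S u m q' v') e))))
  ... | q ∷ʳ′ v | []        = ⊥-elim (∷ʳ≢[] _ [] (T.≈[]⇒≡[] (subst (T._≈ []) (toTree-∷ʳ f S u m q v) e)))
  ... | q ∷ʳ′ v | q' ∷ʳ′ v' with G.pyramid-last u q v pyr | G.pyramid-last u q' v' pyr'
  ...   | refl | refl = G.≈-congʳ (u ∷ [])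
    (G.≈-trans (decompose S u q iq pyr) (G.≈-trans (G.≈-++ under≈ blocks≈) (G.≈-sym (decompose S u q' iq' pyr'))))
    where
    iq  = ++⁻ˡ q iw
    iq' = ++⁻ˡ q' iw'
    lq  = length-∷ʳ≤ q u lw
    lq' = length-∷ʳ≤ q' u lw'
    separate : ∀ q → InS S q → length q ≤ m →
      T.under [] [] (toTree (suc f) S u m (G.under u [] q) ++ toForest f (suc m) (remove u S) (nbrs S u) 0 (G.beside u [] q))
        ≡ toTree (suc f) S u m (G.under u [] q) ×
      T.beside [] [] (toTree (suc f) S u m (G.under u [] q) ++ toForest f (suc m) (remove u S) (nbrs S u) 0 (G.beside u [] q))
        ≡ toForest f (suc m) (remove u S) (nbrs S u) 0 (G.beside u [] q)
    separate q iq lq = T.pyramid++avoiding-split [] _ _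
      (Image.pyramid (toTree-image (suc f) S u fits m _ (G.All-under u [] iq) (G.under-pyramid u [] q) (≤-trans (G.under-length≤ u [] q) lq)))
      (toForest-nonroot f (suc m) (remove u S) (nbrs S u) 0 _)
    parts = T.split-resp-≈ [] [] (T.∷ʳ-cancelʳ [] (subst₂ T._≈_ (toTree-∷ʳ f S u m q u) (toTree-∷ʳ f S u m q' u) e))
    under≈ : G.under u [] q G.≈ G.under u [] q'
    under≈ = toTree-reflects-suc f IH S u fits m _ _ (G.All-under u [] iq) (G.All-under u [] iq')
      (G.under-pyramid u [] q) (G.under-pyramid u [] q')
      (≤-trans (G.under-length≤ u [] q) lq) (≤-trans (G.under-length≤ u [] q') lq')
      (subst₂ T._≈_ (proj₁ (separate q iq lq)) (proj₁ (separate q' iq' lq')) (proj₁ parts))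
    blocks≈ : blocks (nbrs S u) (G.beside u [] q) G.≈ blocks (nbrs S u) (G.beside u [] q')
    blocks≈ = toForest-reflects f IH (suc m) (remove u S) (nbrs S u) 0 _ _ (root-removed-size f S u fits)
      (nbrs-InS S u) (nbrs-unique S u) (beside-InS S u q iq) (beside-InS S u q' iq')
      (≤-trans (G.beside-length≤ u [] q) (m≤n⇒m≤1+n lq)) (≤-trans (G.beside-length≤ u [] q') (m≤n⇒m≤1+n lq'))
      (λ k → restrict-≈ k (subst₂ T._≈_ (proj₂ (separate q iq lq)) (proj₂ (separate q' iq' lq')) (proj₂ parts)))

  toTree-reflects : ∀ f → ReflectInvariant f
  toTree-reflects zero S u (su , sz) m w w' iw iw' pyr pyr' lw lw' e = G.≡⇒≈ (begin
    w                 ≡⟨ sym (map-const w (all-u iw)) ⟩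
    map (λ _ → u) w   ≡⟨ map-const-length w w' (trans (sym (length-map _ w)) (trans (T.≈-length e) (length-map _ w'))) ⟩
    map (λ _ → u) w'  ≡⟨ map-const w' (all-u iw') ⟩
    w'                ∎)
    where
    open ≡-Reasoning
    all-u : ∀ {w} → InS S w → All (_≡ u) w
    all-u = All.map (λ se → size≤1-unique S u _ sz su se)
  toTree-reflects (suc f) = toTree-reflects-suc f (toTree-reflects f)

  removed-avoids : ∀ S' v {B} → InS (remove v S') B → All (_≢ v) B
  removed-avoids S' v = All.map (λ p q → remove-≢ v S' _ p (sym q))

  toForest-∷-split : ∀ f m S' v vs i s B → G.Pyramid v s → InS (remove v S') B →
    toForest f m S' (v ∷ vs) i (s ++ B) ≡ map (i ∷_) (toTree f (component S' v) v m s) ++ toForest f m (remove v S') vs (suc i) B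
  toForest-∷-split f m S' v vs i s B pyr iB =
    cong₂ (λ a b → map (i ∷_) (toTree f (component S' v) v m a) ++ toForest f m (remove v S') vs (suc i) b)
          (proj₁ separated) (proj₂ separated)
    where separated = G.pyramid++avoiding-split v s B pyr (removed-avoids S' v iB)

  toTree-∷ʳ-split : ∀ f S u m s B → G.Pyramid u s → InS (remove u S) B →
    toTree (suc f) S u (suc m) ((s ++ B) ∷ʳ u) ≡ (toTree (suc f) S u m s ++ toForest f (suc m) (remove u S) (nbrs S u) 0 B) ∷ʳ []
  toTree-∷ʳ-split f S u m s B pyr iB =
    trans (toTree-∷ʳ f S u m (s ++ B) u)
      (cong₂ (λ a b → (toTree (suc f) S u m a ++ toForest f (suc m) (remove u S) (nbrs S u) 0 b) ∷ʳ [])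
             (proj₁ separated) (proj₂ separated))
    where separated = G.pyramid++avoiding-split u s B pyr (removed-avoids S u iB)

  record Preimage (f : ℕ) (S : Subset) (v : Fin n) (m : ℕ) (t : List Addr) : Set where
    field
      word    : List (Fin n)
      inS     : InS S word
      pyramid : G.Pyramid v word
      length≡ : length word ≡ length t
      image   : toTree f S v m word T.≈ t

  PreimageInvariant : ℕ → Set
  PreimageInvariant f = ∀ S v → Fits f S v → ∀ m t → All (ValidAddr (build f S v)) t → T.Pyramid [] t → length t ≤ m →
                        Preimage f S v m t

  AbsorbedBy : Fin n → List (Fin n) → List (Fin n) → Set
  AbsorbedBy x vs B = ∀ ctx → All (λ v → G.reaches x v ctx ≡ true) vs → G.under x ctx B ≡ B × G.beside x ctx B ≡ []

  record ForestPreimage (f m : ℕ) (x : Fin n) (ts : List (Tree n)) (S' : Subset) (vs : List (Fin n)) (i : ℕ)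
                        (R : List Addr) : Set where
    field
      word         : List (Fin n)
      rest         : List Addr
      inS          : InS S' word
      absorbed     : AbsorbedBy x vs word
      length≡      : length word ≡ length (toForest f m S' vs i word)
      split        : R T.≈ (toForest f m S' vs i word ++ rest)
      rest-outside : All (OutsideFirstChildren (length ts)) rest
      rest-valid   : All (ValidAddr (node x ts)) rest
      rest-nonroot : All (_≢ []) rest

  toForest-preimage : ∀ f → PreimageInvariant f → ∀ x ts m S' vs i R → Suffix ts i (children f S' vs) → size S' ≤ suc f →
    InS S' vs → Unique vs → All (ValidAddr (node x ts)) R → All (_≢ []) R → All (OutsideFirstChildren i) R → length R ≤ m →
    ForestPreimage f m x ts S' vs i R
  toForest-preimage f IH x ts m S' []       i R pos sz []         []          valid nonroot out lR = record
    { word = [] ; rest = R ; inS = [] ; absorbed = λ _ _ → refl , refl ; length≡ = refl ; split = T.≈-refl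
    ; rest-outside = subst (λ k → All (OutsideFirstChildren k) R) (sym (suffix-end pos)) out
    ; rest-valid = valid ; rest-nonroot = nonroot }
  toForest-preimage f IH x ts m S' (v ∷ vs) i R pos sz (sv ∷ svs) (v∉ ∷ uvs) valid nonroot out lR = record
    { word         = s ++ B.word
    ; rest         = B.rest
    ; inS          = ++⁺ (All.map (component-⊆ S' v sv _) (Preimage.inS D)) (All.map (remove-⊆ v S' _) B.inS)
    ; absorbed     = λ { ctx (g ∷ gs) → G.absorbed-++ x v ctx s B.word (Preimage.pyramid D) (G.reaches-mono x v ctx B.word g)
                                          (proj₁ (B.absorbed ctx gs)) (proj₂ (B.absorbed ctx gs)) }
    ; length≡      = begin
        length (s ++ B.word)                          ≡⟨ length-++ s ⟩
        length s + length B.word                      ≡⟨ cong₂ _+_ s-length B.length≡ ⟩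
        length (map (i ∷_) P) + length K              ≡⟨ sym (length-++ (map (i ∷_) P)) ⟩
        length (map (i ∷_) P ++ K)                    ≡⟨ cong length (sym forest≡) ⟩
        length (toForest f m S' (v ∷ vs) i (s ++ B.word)) ∎
    ; split        = T.≈-trans (T.≈-under++beside (i ∷ []) [] R) (T.≈-trans (T.≡⇒≈ (cong (_++ R₁) A≡))
                       (T.≈-trans (T.≈-++ (prefix-≈ i (T.≈-sym (Preimage.image D))) B.split)
                         (T.≡⇒≈ (trans (sym (++-assoc (map (i ∷_) P) K B.rest)) (cong (_++ B.rest) (sym forest≡))))))
    ; rest-outside = B.rest-outside
    ; rest-valid   = B.rest-valid
    ; rest-nonroot = B.rest-nonroot
    }
    where
    open ≡-Reasoning
    ith = suffix-head pos
    A   = T.under (i ∷ []) [] R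
    R₁  = T.beside (i ∷ []) [] R
    A-inSubtree = under-child-inSubtree i R nonroot
    A≡  = prefix-restrict i A A-inSubtree
    A'  = restrict i A
    D   = IH (component S' v) v (block-Fits f S' v sv sz) m A' (restrict-valid ith A (T.All-under (i ∷ []) [] valid) A-inSubtree)
             (pyramid-prefix⁻ i A' (subst (T.Pyramid (i ∷ [])) A≡ (T.under-pyramid (i ∷ []) [] R)))
             (≤-trans (restrict-length≤ i A) (≤-trans (T.under-length≤ (i ∷ []) [] R) lR))
    s   = Preimage.word D
    P   = toTree f (component S' v) v m s
    outside₁ : All (OutsideFirstChildren (suc i)) R₁
    outside₁ = All.zipWith (λ { (o , ≢i) → outsideFirstChildren-suc i _ o ≢i })
                           (T.All-beside (i ∷ []) [] out , T.beside-avoids (i ∷ []) [] R)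
    module B = ForestPreimage (toForest-preimage f IH x ts m (remove v S') vs (suc i) R₁ (suffix-tail pos) (remove-size S' v f sz)
                 (remove-InS S' v svs v∉) uvs (T.All-beside (i ∷ []) [] valid) (T.All-beside (i ∷ []) [] nonroot)
                 outside₁ (≤-trans (T.beside-length≤ (i ∷ []) [] R) lR))
    K   = toForest f m (remove v S') vs (suc i) B.word
    forest≡ = toForest-∷-split f m S' v vs i s B.word (Preimage.pyramid D) B.inS
    s-length : length s ≡ length (map (i ∷_) P)
    s-length = trans (Preimage.length≡ D) (trans (sym (T.≈-length (Preimage.image D))) (sym (length-map (i ∷_) P)))

  neighbours-reached : ∀ S u → All (λ v → G.reaches u v (u ∷ []) ≡ true) (nbrs S u)
  neighbours-reached S u = All.map (λ { {v} (sv , a) → ∨-introʳ (does (v Data.Fin.≟ u))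
                             (∨-introˡ _ (dec-true (G.dependent? v u) (inj₂ (Adjacent-sym a)))) }) (nbrs-all S u)

  toTree-preimage-suc : ∀ f → PreimageInvariant f → PreimageInvariant (suc f)
  toTree-preimage-suc f IH S u fits zero    []      valid pyr lt = record
    { word = [] ; inS = [] ; pyramid = refl ; length≡ = refl ; image = T.≈-refl }
  toTree-preimage-suc f IH S u fits zero    (_ ∷ _) valid pyr ()
  toTree-preimage-suc f IH S u fits (suc m) t       valid pyr lt with initLast t
  ... | [] = record { word = [] ; inS = [] ; pyramid = refl ; length≡ = refl ; image = T.≈-refl }
  ... | t' ∷ʳ′ x with T.pyramid-last [] t' x pyr
  ...   | refl = record
    { word    = w ∷ʳ u
    ; inS     = ∷ʳ⁺ (++⁺ D.inS (All.map (remove-⊆ u S _) B.inS)) (proj₁ fits)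
    ; pyramid = G.absorbed⇒pyramid-∷ʳ u w (proj₂ (G.absorbed-++ u u (u ∷ []) D.word B.word D.pyramid
                  (G.reaches-self u (B.word ++ u ∷ [])) (proj₁ B-absorbed) (proj₂ B-absorbed)))
    ; length≡ = begin
        length (w ∷ʳ u)                       ≡⟨ length-++ w ⟩
        length w + 1                          ≡⟨ cong (_+ 1) (length-++ D.word) ⟩
        length D.word + length B.word + 1     ≡⟨ cong (_+ 1) (cong₂ _+_ D.length≡ (trans B.length≡ (sym (T.≈-length R≈K)))) ⟩
        length Q₀ + length R + 1              ≡⟨ cong (_+ 1) (T.under-length [] [] t') ⟩
        length t' + 1                         ≡⟨ sym (length-++ t') ⟩
        length (t' ∷ʳ [])                     ∎
    ; image   = T.≈-trans (T.≡⇒≈ (toTree-∷ʳ-split f S u m D.word B.word D.pyramid B.inS))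
                  (T.≈-congʳ ([] ∷ []) (T.≈-trans (T.≈-++ D.image (T.≈-sym R≈K)) (T.≈-sym (T.≈-under++beside [] [] t'))))
    }
    where
    open ≡-Reasoning
    vs     = nbrs S u
    ts     = children f (remove u S) vs
    valid' = ++⁻ˡ t' valid
    lt'    = length-∷ʳ≤ t' [] lt
    Q₀     = T.under [] [] t'
    R      = T.beside [] [] t'
    module D = Preimage (toTree-preimage-suc f IH S u fits m Q₀ (T.All-under [] [] valid') (T.under-pyramid [] [] t')
                 (≤-trans (T.under-length≤ [] [] t') lt'))
    module B = ForestPreimage (toForest-preimage f IH u ts (suc m) (remove u S) vs 0 R ([] , refl , refl)
                 (root-removed-size f S u fits) (nbrs-InS S u) (nbrs-unique S u) (T.All-beside [] [] valid')
                 (T.beside-avoids [] [] t') (All.universal (λ _ _ ()) R) (≤-trans (T.beside-length≤ [] [] t') (m≤n⇒m≤1+n lt')))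
    K = toForest f (suc m) (remove u S) vs 0 B.word
    w = D.word ++ B.word
    t'≈ : t' T.≈ ((Q₀ ++ K) ++ B.rest)
    t'≈ = T.≈-trans (T.≈-under++beside [] [] t') (T.≈-trans (T.≈-congˡ Q₀ B.split) (T.≡⇒≈ (sym (++-assoc Q₀ K B.rest))))
    R≈K : R T.≈ K
    R≈K = T.≈-trans B.split (T.≡⇒≈ (trans (cong (K ++_) (outside-children-empty u ts t' (Q₀ ++ K) B.rest pyr t'≈
            B.rest-outside B.rest-valid B.rest-nonroot)) (++-identityʳ K)))
    B-absorbed = B.absorbed (u ∷ []) (neighbours-reached S u)

  toTree-preimage : ∀ f → PreimageInvariant f
  toTree-preimage zero S u (su , sz) m t valid pyr lt = record
    { word    = map (λ _ → u) t
    ; inS     = All.map⁺ (All.universal (λ _ → su) t)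
    ; pyramid = G.all-x⇒beside≡[] u [] _ (All.map⁺ (All.universal (λ _ → refl) t))
    ; length≡ = length-map _ t
    ; image   = T.≡⇒≈ (trans (sym (map-∘ t)) (map-const t (All.map root-only valid)))
    }
    where
    root-only : ∀ {a} → ValidAddr (node u []) a → a ≡ []
    root-only {[]}    _ = refl
    root-only {j ∷ a} v = case proj₂ (valid-child-nth {x = u} {[]} {j} {a} v) of λ ()
  toTree-preimage (suc f) = toTree-preimage-suc f (toTree-preimage f)

theorem3p1 : (n : ℕ) (adj : Fin n → Fin n → Bool) →
    Symmetric adj → Irreflexive adj → Connected adj → (u : Fin n) →
    Σ (List (Fin n) → List Addr) λ φ →
        (∀ w → InPG adj u w → ValidWord (stablePathTree adj u) (φ w) × InPT [] (φ w))
      × (∀ w w' → InPG adj u w → InPG adj u w' → EqG adj w w' → EqT (φ w) (φ w'))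
      × (∀ w w' → InPG adj u w → InPG adj u w' → EqT (φ w) (φ w') → EqG adj w w')
      × (∀ t → ValidWord (stablePathTree adj u) t → InPT [] t →
           ∃ λ w → InPG adj u w × EqT (φ w) t)
      × (∀ w → InPG adj u w → length (φ w) ≡ length w)
      × (∀ w → InPG adj u w → map (label (stablePathTree adj u)) (φ w) ↭ w)
theorem3p1 n adj symm irr _ u =
    φ
  , (λ w h → All⇒ValidWord (Image.valid (image w h)) , T.Pyramid⇒InP [] (φ w) (Image.pyramid (image w h)))
  , (λ w w' h h' e → subst (λ k → φ w T.≈ toTree n full u k w') (G.≈-length e)
                       (toTree-resp-≈ n full u (length w) w w' (pyr h) (pyr h') ≤-refl e))
  , (λ w w' h h' e → let same = trans (sym (Image.length≡ (image w h))) (trans (T.≈-length e) (Image.length≡ (image w' h'))) in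
       toTree-reflects n full u fits (length w) w w' (inFull w) (inFull w') (pyr h) (pyr h') ≤-refl (≤-reflexive (sym same))
         (subst (λ k → φ w T.≈ toTree n full u k w') (sym same) e))
  , (λ t v h → let module P = Preimage (toTree-preimage n full u fits (length t) t (ValidWord⇒All v) (T.InP⇒Pyramid [] t h) ≤-refl) in
       P.word , G.Pyramid⇒InP u P.word P.pyramid , subst (λ k → toTree n full u k P.word T.≈ t) (sym P.length≡) P.image)
  , (λ w h → Image.length≡ (image w h))
  , (λ w h → Image.labels (image w h))
  where
  open Construction adj symm irr
  open Graph adj symm using (Subset; size≤n; module G)
  full : Subset
  full _ = true
  fits : Fits n full u
  fits = refl , m≤n⇒m≤1+n (size≤n full)
  inFull : ∀ w → InS full w
  inFull = All.universal (λ _ → refl)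
  pyr : ∀ {w} → InPG adj u w → G.Pyramid u w
  pyr {w} = G.InP⇒Pyramid u w
  φ : List (Fin n) → List Addr
  φ w = toTree n full u (length w) w
  image : ∀ w → InPG adj u w → Image (stablePathTree adj u) w (φ w)
  image w h = toTree-image n full u fits (length w) w (inFull w) (pyr h) ≤-refl
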